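{- Let $n\ge 1$, $u\in S_n$, and let $1\le i<n$ be such that $\ell(us_i)<\ell(u)$; put $u'=us_i$. Then \[ \mathfrak{G}_u(y_u;y)=\left(1-\frac{y_{u(i+1)}}{y_{u(i)}}\right)\mathfrak{G}_{u'}(y_{u'};y). \]
   Context: $S_n$ is the symmetric group on $\{1,\dots,n\}$; a permutation $w$ is written in one-line notation $w=w(1)\cdots w(n)$. $s_i$ denotes the adjacent transposition $(i,i+1)$, and $ws_i$ is obtained from $w$ by swapping the entries in positions $i$ and $i+1$. The length $\ell(w)$ is the number of pairs $i<j$ with $w(i)>w(j)$. Work in the ring $\mathbb{Z}[x_1^{\pm1},\dots,x_n^{\pm1},y_1^{\pm1},\dots,y_n^{\pm1}]$ of Laurent polynomials. The double Grothendieck polynomials $\mathfrak{G}_w(x;y)$, $w\in S_n$, are defined as follows: for the longest permutation $w_0=n\cdots 21$, $\mathfrak{G}_{w_0}(x;y)=\prod_{i+j\le n}\left(1-\frac{y_j}{x_i}\right)$; for $w\ne w_0$, choose $i$ with $\ell(ws_i)=\ell(w)+1$ and set \[\mathfrak{G}_w(x;y)=\frac{x_i\,\mathfrak{G}_{ws_i}(x;y)-x_{i+1}\,\mathfrak{G}_{ws_i}(\dots,x_{i+1},x_i,\dots;y)}{x_i-x_{i+1}},\] where in the second term $x_i$ and $x_{i+1}$ are interchanged (this is independent of the choice of $i$). For $v\in S_n$, $\mathfrak{G}_w(y_v;y)$ denotes the specialization obtained by replacing each $x_j$ by $y_{v(j)}$. -}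

module Defs where

open import Data.Nat as ℕ using (ℕ; zero; suc; _<_)
open import Data.Integer as ℤ using (ℤ; +_; -[1+_])
open import Data.Fin as Fin using (Fin; fromℕ<; opposite; toℕ)
open import Data.Fin.Properties using (<⇒≤pred)
open import Data.Vec as Vec using (Vec; lookup; replicate; zipWith; _[_]≔_; _[_]%=_)
open import Data.Vec.Properties using (≡-dec)
open import Data.List as List using (List; []; _∷_; _++_; map; concatMap; foldr; allFin)
open import Data.Nat.ListAction using (sum)
open import Data.Product using (_×_; _,_; ∃-syntax)
open import Data.Bool using (Bool; true; false; if_then_else_; _∧_)
open import Relation.Nullary using (yes; no; ⌊_⌋)
open import Relation.Binary.PropositionalEquality using (_≡_)
open import Data.Nat.Properties using (<-trans; n<1+n)

-- Laurent polynomials in ℤ[x₁^±1..xₙ^±1, y₁^±1..yₙ^±1]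
-- A term (c , a , b) stands for c · x^a · y^b, exponent vectors a b ∈ ℤⁿ.

Term : ℕ → Set
Term n = ℤ × Vec ℤ n × Vec ℤ n

Laurent : ℕ → Set
Laurent n = List (Term n)

module _ {n : ℕ} where

  coeff : Laurent n → Vec ℤ n → Vec ℤ n → ℤ
  coeff [] a b = + 0
  coeff ((c , a' , b') ∷ p) a b with ≡-dec ℤ._≟_ a a' | ≡-dec ℤ._≟_ b b'
  ... | yes _ | yes _ = c ℤ.+ coeff p a b
  ... | _     | _     = coeff p a b

  infix 4 _≈_
  _≈_ : Laurent n → Laurent n → Set
  p ≈ q = ∀ a b → coeff p a b ≡ coeff q a b

  zeroV : Vec ℤ n
  zeroV = replicate n (+ 0)

  mono : ℤ → Vec ℤ n → Vec ℤ n → Laurent n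
  mono c a b = (c , a , b) ∷ []

  one : Laurent n
  one = mono (+ 1) zeroV zeroV

  -- x_k^e and y_k^e (k 0-based)
  xpow : Fin n → ℤ → Laurent n
  xpow k e = mono (+ 1) (zeroV [ k ]≔ e) zeroV

  ypow : Fin n → ℤ → Laurent n
  ypow k e = mono (+ 1) zeroV (zeroV [ k ]≔ e)

  infixl 6 _⊕_ _⊖_
  infixl 7 _⊗_

  _⊕_ : Laurent n → Laurent n → Laurent n
  p ⊕ q = p ++ q

  neg : Laurent n → Laurent n
  neg = map (λ { (c , a , b) → (ℤ.- c , a , b) })

  _⊖_ : Laurent n → Laurent n → Laurent n
  p ⊖ q = p ++ neg q

  _⊗_ : Laurent n → Laurent n → Laurent n
  p ⊗ q = concatMap (λ { (c , a , b) →
            map (λ { (d , a' , b') → (c ℤ.* d , zipWith ℤ._+_ a a' , zipWith ℤ._+_ b b') }) q }) p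

  prodL : List (Laurent n) → Laurent n
  prodL = foldr _⊗_ one

  swapVec : {A : Set} → Fin n → Fin n → Vec A n → Vec A n
  swapVec k l a = (a [ k ]≔ lookup a l) [ l ]≔ lookup a k

  swapX : Fin n → Fin n → Laurent n → Laurent n
  swapX k l = map (λ { (c , a , b) → (c , swapVec k l a , b) })

-- Permutations of {1..n} in one-line notation (0-based: entries in Fin n)

OneLine : ℕ → Set
OneLine n = Vec (Fin n) n

IsPerm : {n : ℕ} → OneLine n → Set
IsPerm {n} w = ∀ (k : Fin n) → ∃[ j ] lookup w j ≡ k

pos : {n : ℕ} (i : ℕ) → suc i < n → Fin n
pos i h = fromℕ< (<-trans (n<1+n i) h)

pos+1 : {n : ℕ} (i : ℕ) → suc i < n → Fin n
pos+1 i h = fromℕ< h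

-- w s_i : swap entries in positions i and i+1 (0-based i here, i.e. paper's s_{i+1})
rightMulS : {n : ℕ} → OneLine n → (i : ℕ) → suc i < n → OneLine n
rightMulS w i h = swapVec (pos i h) (pos+1 i h) w

pairs : (n : ℕ) → List (Fin n × Fin n)
pairs n = concatMap (λ p → map (p ,_) (allFin n)) (allFin n)

len : {n : ℕ} → OneLine n → ℕ
len {n} w = sum (map (λ { (p , q) →
   if ⌊ p Fin.<? q ⌋ ∧ ⌊ lookup w q Fin.<? lookup w p ⌋ then 1 else 0 }) (pairs n))

-- ∏_{i+j ≤ n} (1 - y_j / x_i)   (1-based i,j; 0-based p,q with p+q+2 ≤ n)
topG : (n : ℕ) → Laurent n
topG n = prodL (concatMap (λ { (p , q) →
  if ⌊ suc (suc (toℕ p ℕ.+ toℕ q)) ℕ.≤? n ⌋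
  then (one ⊖ (ypow q (+ 1) ⊗ xpow p -[1+ 0 ])) ∷ [] else [] }) (pairs n))

-- A family G indexed by one-line notations satisfies the defining recursion
-- of the double Grothendieck polynomials: value at w₀, and for each w and
-- each i with ℓ(w s_i) = ℓ(w)+1, the divided-difference relation
-- (x_i - x_{i+1}) G_w = x_i G_{ws_i} - x_{i+1} (G_{ws_i} with x_i ↔ x_{i+1}).
record IsDoubleGrothendieck (n : ℕ) (G : OneLine n → Laurent n) : Set where
  field
    top : ∀ (w : OneLine n) → (∀ k → lookup w k ≡ opposite k) → G w ≈ topG n
    step : ∀ (w : OneLine n) → IsPerm w → (i : ℕ) (h : suc i < n) →
           len (rightMulS w i h) ≡ suc (len w) →
           (xpow (pos i h) (+ 1) ⊖ xpow (pos+1 i h) (+ 1)) ⊗ G w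
             ≈ xpow (pos i h) (+ 1) ⊗ G (rightMulS w i h)
               ⊖ xpow (pos+1 i h) (+ 1) ⊗ swapX (pos i h) (pos+1 i h) (G (rightMulS w i h))

-- specialization x_j ↦ y_{v(j)}
specExp : {n : ℕ} → OneLine n → Vec ℤ n → Vec ℤ n → Vec ℤ n
specExp {n} v a b = foldr (λ j acc → acc [ lookup v j ]%= (ℤ._+_ (lookup a j))) b (allFin n)

specialize : {n : ℕ} → OneLine n → Laurent n → Laurent n
specialize v = map (λ { (c , a , b) → (c , zeroV , specExp v a b) })

-- Since ℓ(u s_i) < ℓ(u), G_{u s_i} is the i-th divided difference of G_u; specialized at x = y_{u s_i}
-- this reads
--   (y_{u(i+1)} - y_{u(i)}) G_{u s_i}(y_{u s_i}) = y_{u(i+1)} G_u(y_{u s_i}) - y_{u(i)} G_u(y_u),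
-- so the identity follows from G_u(y_{u s_i}) = 0. That is an instance of the vanishing property
-- G_w(y_v) = 0 whenever w ≰ v in the Bruhat order (detected by rank counts), proved by downward
-- induction on ℓ(w). For w = w₀ some factor 1 - y_{v(p)}/x_p of G_{w₀} vanishes at y_v. Otherwise w has
-- an ascent i; the relation expresses (y_{v(i)} - y_{v(i+1)}) G_w(y_v) through G_{w s_i}(y_v) and
-- G_{w s_i}(y_{v s_i}), which vanish by induction and the lifting property of the Bruhat order, and
-- y_{v(i)} - y_{v(i+1)} is not a zero divisor.

module Submission where

open import Defs
open import Level using (0ℓ)
open import Algebra.Bundles using (CommutativeMonoid)
import Algebra.Properties.CommutativeMonoid.Sum as Sum
open import Data.Bool using (Bool; true; false; if_then_else_; _∧_)
open import Data.Bool.Properties using (∧-zeroʳ)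
open import Data.Empty using (⊥-elim)
open import Data.Fin as Fin using (Fin; toℕ; fromℕ<; opposite)
import Data.Fin.Permutation as Perm
import Data.Fin.Permutation.Components as PC
import Data.Fin.Properties as FP
open import Data.Integer as ℤ using (ℤ; +_; -[1+_]; _+_; _-_; _*_; -_; ∣_∣)
import Data.Integer.Properties as ℤP
open import Data.Integer.Tactic.RingSolver using (solve-∀)
open import Data.List as List using (List; []; _∷_; _++_; concatMap; length; allFin)
import Data.List.Properties as LP
open import Data.List.Relation.Unary.Any using (Any; here; there)
import Data.List.Relation.Unary.Any.Properties as AnyP
open import Data.Nat as ℕ using (ℕ; zero; suc; _≤_; _<_; z≤n; s≤s; _∸_)
import Data.Nat.ListAction as ℕL
import Data.Nat.ListAction.Properties as ℕLP
import Data.Nat.Properties as ℕP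
open import Data.Product using (_×_; _,_; proj₁; proj₂; ∃-syntax)
open import Data.Vec using (Vec; lookup; zipWith; _[_]≔_; _[_]%=_)
open import Data.Vec.Properties using (≡-dec)
import Data.Vec.Properties as VP
open import Data.Vec.Relation.Binary.Pointwise.Extensional using (ext; Pointwise-≡⇒≡)
open import Function using (_∘_)
open import Function.Bundles using (mk⇔)
open import Function.Definitions using (Injective)
open import Relation.Binary.Definitions using (tri<; tri≈; tri>)
open import Relation.Binary.PropositionalEquality
open import Relation.Nullary using (yes; no; ¬_; Dec; ⌊_⌋)
open import Relation.Nullary.Decidable using (isYes≗does; dec-true; dec-false; does-⇔; _×-dec_)

module _ {n : ℕ} where

  infixl 6 _+ᵥ_ _−ᵥ_

  _+ᵥ_ _−ᵥ_ : Vec ℤ n → Vec ℤ n → Vec ℤ n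
  _+ᵥ_ = zipWith ℤ._+_
  _−ᵥ_ = zipWith ℤ._-_

  unitᵥ : Fin n → ℤ → Vec ℤ n
  unitᵥ k e = zeroV [ k ]≔ e

  pointwise : {a b : Vec ℤ n} → (∀ j → lookup a j ≡ lookup b j) → a ≡ b
  pointwise = Pointwise-≡⇒≡ ∘ ext

  lookup-+ᵥ : ∀ a b j → lookup (a +ᵥ b) j ≡ lookup a j + lookup b j
  lookup-+ᵥ a b j = VP.lookup-zipWith _+_ j a b

  lookup-−ᵥ : ∀ a b j → lookup (a −ᵥ b) j ≡ lookup a j - lookup b j
  lookup-−ᵥ a b j = VP.lookup-zipWith _-_ j a b

  lookup-zeroV : ∀ j → lookup (zeroV {n}) j ≡ + 0
  lookup-zeroV j = VP.lookup-replicate j (+ 0)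

  lookup-unitᵥ-≢ : ∀ {k j} e → j ≢ k → lookup (unitᵥ k e) j ≡ + 0
  lookup-unitᵥ-≢ {j = j} e j≢k = trans (VP.lookup∘update′ j≢k zeroV e) (lookup-zeroV j)

  +ᵥ-comm : ∀ a b → a +ᵥ b ≡ b +ᵥ a
  +ᵥ-comm = VP.zipWith-comm ℤP.+-comm

  +ᵥ-identityˡ : ∀ a → zeroV +ᵥ a ≡ a
  +ᵥ-identityˡ = VP.zipWith-identityˡ ℤP.+-identityˡ

  −ᵥ-identityʳ : ∀ a → a −ᵥ zeroV ≡ a
  −ᵥ-identityʳ = VP.zipWith-identityʳ ℤP.+-identityʳ

  +ᵥ-−ᵥ-cancel : ∀ a e → (a +ᵥ e) −ᵥ e ≡ a
  +ᵥ-−ᵥ-cancel a e = pointwise λ j → begin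
      lookup ((a +ᵥ e) −ᵥ e) j               ≡⟨ lookup-−ᵥ (a +ᵥ e) e j ⟩
      lookup (a +ᵥ e) j - lookup e j       ≡⟨ cong (_- lookup e j) (lookup-+ᵥ a e j) ⟩
      lookup a j + lookup e j - lookup e j ≡⟨ cancel (lookup a j) (lookup e j) ⟩
      lookup a j ∎
    where
    open ≡-Reasoning
    cancel : ∀ x y → x + y - y ≡ x
    cancel = solve-∀

  −ᵥ-+ᵥ-cancel : ∀ a e → e +ᵥ (a −ᵥ e) ≡ a
  −ᵥ-+ᵥ-cancel a e = pointwise λ j → begin
      lookup (e +ᵥ (a −ᵥ e)) j                ≡⟨ lookup-+ᵥ e (a −ᵥ e) j ⟩
      lookup e j + lookup (a −ᵥ e) j        ≡⟨ cong (_+_ (lookup e j)) (lookup-−ᵥ a e j) ⟩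
      lookup e j + (lookup a j - lookup e j) ≡⟨ cancel (lookup a j) (lookup e j) ⟩
      lookup a j ∎
    where
    open ≡-Reasoning
    cancel : ∀ x y → y + (x - y) ≡ x
    cancel = solve-∀

  −ᵥ≡⇒≡+ᵥ : ∀ {a e a'} → a −ᵥ e ≡ a' → a ≡ e +ᵥ a'
  −ᵥ≡⇒≡+ᵥ {a} {e} refl = sym (−ᵥ-+ᵥ-cancel a e)

  ≡+ᵥ⇒−ᵥ≡ : ∀ {a e a'} → a ≡ e +ᵥ a' → a −ᵥ e ≡ a'
  ≡+ᵥ⇒−ᵥ≡ {e = e} {a'} refl = trans (cong (_−ᵥ e) (+ᵥ-comm e a')) (+ᵥ-−ᵥ-cancel a' e)

-- Coefficients of Laurent polynomials

module _ {n : ℕ} where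

  termCoeff : Term n → Vec ℤ n → Vec ℤ n → ℤ
  termCoeff (c , a' , b') a b with ≡-dec ℤ._≟_ a a' | ≡-dec ℤ._≟_ b b'
  ... | yes _ | yes _ = c
  ... | _     | _     = + 0

  coeff-∷ : ∀ t p a b → coeff (t ∷ p) a b ≡ termCoeff t a b + coeff p a b
  coeff-∷ (c , a' , b') p a b with ≡-dec ℤ._≟_ a a' | ≡-dec ℤ._≟_ b b'
  ... | yes _ | yes _ = refl
  ... | yes _ | no _  = sym (ℤP.+-identityˡ _)
  ... | no _  | _     = sym (ℤP.+-identityˡ _)

  termCoeff-≡ : ∀ c {a' b' a b} → a ≡ a' → b ≡ b' → termCoeff (c , a' , b') a b ≡ c
  termCoeff-≡ c {a'} {b'} {a} {b} a≡a' b≡b' with ≡-dec ℤ._≟_ a a' | ≡-dec ℤ._≟_ b b'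
  ... | yes _   | yes _   = refl
  ... | yes _   | no b≢b' = ⊥-elim (b≢b' b≡b')
  ... | no a≢a' | _       = ⊥-elim (a≢a' a≡a')

  termCoeff-≢ : ∀ c {a' b' a b} → ¬ (a ≡ a' × b ≡ b') → termCoeff (c , a' , b') a b ≡ + 0
  termCoeff-≢ c {a'} {b'} {a} {b} ≢ with ≡-dec ℤ._≟_ a a' | ≡-dec ℤ._≟_ b b'
  ... | yes a≡a' | yes b≡b' = ⊥-elim (≢ (a≡a' , b≡b'))
  ... | yes _    | no _     = refl
  ... | no _     | _        = refl

  termCoeff-+ : ∀ c d e f a b → termCoeff (c + d , e , f) a b ≡ termCoeff (c , e , f) a b + termCoeff (d , e , f) a b
  termCoeff-+ c d e f a b with ≡-dec ℤ._≟_ a e | ≡-dec ℤ._≟_ b f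
  ... | yes _ | yes _ = refl
  ... | yes _ | no _  = refl
  ... | no _  | _     = refl

  termCoeff-0 : ∀ e f a b → termCoeff (+ 0 , e , f) a b ≡ + 0
  termCoeff-0 e f a b with ≡-dec ℤ._≟_ a e | ≡-dec ℤ._≟_ b f
  ... | yes _ | yes _ = refl
  ... | yes _ | no _  = refl
  ... | no _  | _     = refl

  infixl 7 _·ₜ_
  _·ₜ_ : Term n → Term n → Term n
  (c , e , f) ·ₜ (d , a , b) = c * d , e +ᵥ a , f +ᵥ b

  termCoeff-shift : ∀ c d e f a b x y →
    termCoeff ((c , e , f) ·ₜ (d , a , b)) x y ≡ c * termCoeff (d , a , b) (x −ᵥ e) (y −ᵥ f)
  termCoeff-shift c d e f a b x y with ≡-dec ℤ._≟_ (x −ᵥ e) a | ≡-dec ℤ._≟_ (y −ᵥ f) b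
  ... | yes x≡ | yes y≡ = termCoeff-≡ (c * d) (−ᵥ≡⇒≡+ᵥ x≡) (−ᵥ≡⇒≡+ᵥ y≡)
  ... | yes _  | no y≢  = trans (termCoeff-≢ (c * d) λ (_ , y≡) → y≢ (≡+ᵥ⇒−ᵥ≡ y≡)) (sym (ℤP.*-zeroʳ c))
  ... | no x≢  | _      = trans (termCoeff-≢ (c * d) λ (x≡ , _) → x≢ (≡+ᵥ⇒−ᵥ≡ x≡)) (sym (ℤP.*-zeroʳ c))

  termCoeff-shiftʳ : ∀ c d e f a b x y →
    termCoeff ((c , e , f) ·ₜ (d , a , b)) x y ≡ d * termCoeff (c , e , f) (x −ᵥ a) (y −ᵥ b)
  termCoeff-shiftʳ c d e f a b x y = begin
    termCoeff (c * d , e +ᵥ a , f +ᵥ b) x y ≡⟨ cong₂ (λ k E → termCoeff (k , E) x y) (ℤP.*-comm c d) (cong₂ _,_ (+ᵥ-comm e a) (+ᵥ-comm f b)) ⟩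
    termCoeff (d * c , a +ᵥ e , b +ᵥ f) x y ≡⟨ termCoeff-shift d c a b e f x y ⟩
    d * termCoeff (c , e , f) (x −ᵥ a) (y −ᵥ b) ∎
    where open ≡-Reasoning

  coeff-++ : ∀ p q a b → coeff (p ++ q) a b ≡ coeff p a b + coeff q a b
  coeff-++ []      q a b = sym (ℤP.+-identityˡ _)
  coeff-++ (t ∷ p) q a b = begin
    coeff (t ∷ p ++ q) a b                         ≡⟨ coeff-∷ t (p ++ q) a b ⟩
    termCoeff t a b + coeff (p ++ q) a b            ≡⟨ cong (_+_ (termCoeff t a b)) (coeff-++ p q a b) ⟩
    termCoeff t a b + (coeff p a b + coeff q a b)   ≡⟨ ℤP.+-assoc (termCoeff t a b) (coeff p a b) (coeff q a b) ⟨
    termCoeff t a b + coeff p a b + coeff q a b     ≡⟨ cong (_+ coeff q a b) (coeff-∷ t p a b) ⟨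
    coeff (t ∷ p) a b + coeff q a b ∎
    where open ≡-Reasoning

  coeff-map-scaled : ∀ (F : Term n → Term n) k {x y x' y'} →
    (∀ t → termCoeff (F t) x y ≡ k * termCoeff t x' y') →
    ∀ p → coeff (List.map F p) x y ≡ k * coeff p x' y'
  coeff-map-scaled F k hF []      = sym (ℤP.*-zeroʳ k)
  coeff-map-scaled F k {x} {y} {x'} {y'} hF (t ∷ p) = begin
    coeff (F t ∷ List.map F p) x y                   ≡⟨ coeff-∷ (F t) _ x y ⟩
    termCoeff (F t) x y + coeff (List.map F p) x y    ≡⟨ cong₂ _+_ (hF t) (coeff-map-scaled F k hF p) ⟩
    k * termCoeff t x' y' + k * coeff p x' y'         ≡⟨ ℤP.*-distribˡ-+ k _ _ ⟨
    k * (termCoeff t x' y' + coeff p x' y')           ≡⟨ cong (k *_) (coeff-∷ t p x' y') ⟨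
    k * coeff (t ∷ p) x' y' ∎
    where open ≡-Reasoning

  coeff-neg : ∀ p a b → coeff (neg p) a b ≡ - coeff p a b
  coeff-neg p a b = trans (coeff-map-scaled _ -[1+ 0 ] (λ (c , e , f) → termCoeff-neg c e f) p) (ℤP.-1*i≡-i (coeff p a b))
    where
    termCoeff-neg : ∀ c e f → termCoeff (- c , e , f) a b ≡ -[1+ 0 ] * termCoeff (c , e , f) a b
    termCoeff-neg c e f with ≡-dec ℤ._≟_ a e | ≡-dec ℤ._≟_ b f
    ... | yes _ | yes _ = sym (ℤP.-1*i≡-i c)
    ... | yes _ | no _  = refl
    ... | no _  | _     = refl

  coeff-⊖ : ∀ p q a b → coeff (p ⊖ q) a b ≡ coeff p a b - coeff q a b
  coeff-⊖ p q a b = trans (coeff-++ p (neg q) a b) (cong (_+_ (coeff p a b)) (coeff-neg q a b))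

  coeff-∷-⊗ : ∀ c e f p q x y →
    coeff (((c , e , f) ∷ p) ⊗ q) x y ≡ c * coeff q (x −ᵥ e) (y −ᵥ f) + coeff (p ⊗ q) x y
  coeff-∷-⊗ c e f p q x y =
    trans (coeff-++ (List.map _ q) (p ⊗ q) x y)
          (cong (_+ coeff (p ⊗ q) x y) (coeff-map-scaled _ c (λ (d , a , b) → termCoeff-shift c d e f a b x y) q))

  coeff-⊗-∷ : ∀ p d e f q x y →
    coeff (p ⊗ ((d , e , f) ∷ q)) x y ≡ d * coeff p (x −ᵥ e) (y −ᵥ f) + coeff (p ⊗ q) x y
  coeff-⊗-∷ [] d e f q x y = sym (trans (ℤP.+-identityʳ _) (ℤP.*-zeroʳ d))
  coeff-⊗-∷ ((c , e' , f') ∷ p) d e f q x y = begin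
    coeff (((c , e' , f') ∷ p) ⊗ ((d , e , f) ∷ q)) x y
      ≡⟨ coeff-∷ (c * d , e' +ᵥ e , f' +ᵥ f) _ x y ⟩
    termCoeff (c * d , e' +ᵥ e , f' +ᵥ f) x y + coeff (List.map _ q ++ p ⊗ ((d , e , f) ∷ q)) x y
      ≡⟨ cong₂ _+_ (termCoeff-shiftʳ c d e' f' e f x y) (coeff-++ (List.map _ q) _ x y) ⟩
    d * T + (Q + coeff (p ⊗ ((d , e , f) ∷ q)) x y)
      ≡⟨ cong (λ z → d * T + (Q + z)) (coeff-⊗-∷ p d e f q x y) ⟩
    d * T + (Q + (d * P + R))
      ≡⟨ rearrange d T Q P R ⟩
    d * (T + P) + (Q + R)
      ≡⟨ cong₂ (λ u v → d * u + v) (coeff-∷ (c , e' , f') p (x −ᵥ e) (y −ᵥ f)) (coeff-++ (List.map _ q) (p ⊗ q) x y) ⟨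
    d * coeff ((c , e' , f') ∷ p) (x −ᵥ e) (y −ᵥ f) + coeff (((c , e' , f') ∷ p) ⊗ q) x y ∎
    where
    open ≡-Reasoning
    T P Q R : ℤ
    T = termCoeff (c , e' , f') (x −ᵥ e) (y −ᵥ f)
    P = coeff p (x −ᵥ e) (y −ᵥ f)
    Q = coeff (List.map _ q) x y
    R = coeff (p ⊗ q) x y
    rearrange : ∀ d T Q P R → d * T + (Q + (d * P + R)) ≡ d * (T + P) + (Q + R)
    rearrange = solve-∀

  coeff-mono-⊗ : ∀ c e f q x y → coeff (mono c e f ⊗ q) x y ≡ c * coeff q (x −ᵥ e) (y −ᵥ f)
  coeff-mono-⊗ c e f q x y = trans (coeff-∷-⊗ c e f [] q x y) (ℤP.+-identityʳ _)

  IsZero : Laurent n → Set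
  IsZero p = ∀ a b → coeff p a b ≡ + 0

  IsZero-resp-≈ : ∀ p q → p ≈ q → IsZero q → IsZero p
  IsZero-resp-≈ p q p≈q zq a b = trans (p≈q a b) (zq a b)

  ≈⇒IsZero-⊖ : ∀ p q → p ≈ q → IsZero (p ⊖ q)
  ≈⇒IsZero-⊖ p q p≈q a b = trans (coeff-⊖ p q a b) (ℤP.i≡j⇒i-j≡0 (p≈q a b))

  IsZero-⊖⇒≈ : ∀ p q → IsZero (p ⊖ q) → p ≈ q
  IsZero-⊖⇒≈ p q z a b = ℤP.i-j≡0⇒i≡j (coeff p a b) (coeff q a b) (trans (sym (coeff-⊖ p q a b)) (z a b))

  IsZero-⊖ : ∀ p q → IsZero p → IsZero q → IsZero (p ⊖ q)
  IsZero-⊖ p q zp zq a b = trans (coeff-⊖ p q a b) (cong₂ _-_ (zp a b) (zq a b))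

  IsZero-⊗ʳ : ∀ p q → IsZero q → IsZero (p ⊗ q)
  IsZero-⊗ʳ []                q zq x y = refl
  IsZero-⊗ʳ ((c , e , f) ∷ p) q zq x y = begin
    coeff (((c , e , f) ∷ p) ⊗ q) x y                  ≡⟨ coeff-∷-⊗ c e f p q x y ⟩
    c * coeff q (x −ᵥ e) (y −ᵥ f) + coeff (p ⊗ q) x y   ≡⟨ cong₂ _+_ (cong (c *_) (zq (x −ᵥ e) (y −ᵥ f))) (IsZero-⊗ʳ p q zq x y) ⟩
    c * + 0 + + 0                                       ≡⟨ cong (_+ + 0) (ℤP.*-zeroʳ c) ⟩
    + 0 ∎
    where open ≡-Reasoning

  IsZero-⊗ˡ : ∀ p q → IsZero p → IsZero (p ⊗ q)
  IsZero-⊗ˡ p []                zp x y = IsZero-⊗ʳ p [] (λ _ _ → refl) x y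
  IsZero-⊗ˡ p ((d , e , f) ∷ q) zp x y = begin
    coeff (p ⊗ ((d , e , f) ∷ q)) x y                  ≡⟨ coeff-⊗-∷ p d e f q x y ⟩
    d * coeff p (x −ᵥ e) (y −ᵥ f) + coeff (p ⊗ q) x y   ≡⟨ cong₂ _+_ (cong (d *_) (zp (x −ᵥ e) (y −ᵥ f))) (IsZero-⊗ˡ p q zp x y) ⟩
    d * + 0 + + 0                                       ≡⟨ cong (_+ + 0) (ℤP.*-zeroʳ d) ⟩
    + 0 ∎
    where open ≡-Reasoning

  IsZero-prodL : ∀ {L} → Any IsZero L → IsZero (prodL L)
  IsZero-prodL {p ∷ L} (here zp)  = IsZero-⊗ˡ p (prodL L) zp
  IsZero-prodL {p ∷ L} (there zL) = IsZero-⊗ʳ p (prodL L) (IsZero-prodL zL)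

module _ {n : ℕ} where

  mapExponents : (Vec ℤ n → Vec ℤ n → Vec ℤ n × Vec ℤ n) → Laurent n → Laurent n
  mapExponents f = List.map λ (c , a , b) → c , f a b

  termsAt termsOff : Vec ℤ n → Vec ℤ n → Laurent n → Laurent n
  termsAt a b [] = []
  termsAt a b ((c , a' , b') ∷ p) with ≡-dec ℤ._≟_ a a' | ≡-dec ℤ._≟_ b b'
  ... | yes _ | yes _ = (c , a' , b') ∷ termsAt a b p
  ... | _     | _     = termsAt a b p
  termsOff a b [] = []
  termsOff a b ((c , a' , b') ∷ p) with ≡-dec ℤ._≟_ a a' | ≡-dec ℤ._≟_ b b'
  ... | yes _ | yes _ = termsOff a b p
  ... | _     | _     = (c , a' , b') ∷ termsOff a b p

  private
    module _ (F : Term n → Term n) (t : Term n) {p A O : Laurent n} (x y : Vec ℤ n)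
             (ih : coeff (List.map F p) x y ≡ coeff (List.map F A) x y + coeff (List.map F O) x y) where

      partition-hit : coeff (List.map F (t ∷ p)) x y ≡ coeff (List.map F (t ∷ A)) x y + coeff (List.map F O) x y
      partition-hit = begin
        coeff (List.map F (t ∷ p)) x y       ≡⟨ coeff-∷ (F t) _ x y ⟩
        T + coeff (List.map F p) x y         ≡⟨ cong (_+_ T) ih ⟩
        T + (coeff (List.map F A) x y + Off) ≡⟨ ℤP.+-assoc T _ Off ⟨
        T + coeff (List.map F A) x y + Off   ≡⟨ cong (_+ Off) (coeff-∷ (F t) _ x y) ⟨
        coeff (List.map F (t ∷ A)) x y + Off ∎
        where
        open ≡-Reasoning
        T Off : ℤ
        T = termCoeff (F t) x y
        Off = coeff (List.map F O) x y

      partition-miss : coeff (List.map F (t ∷ p)) x y ≡ coeff (List.map F A) x y + coeff (List.map F (t ∷ O)) x y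
      partition-miss = begin
        coeff (List.map F (t ∷ p)) x y ≡⟨ coeff-∷ (F t) _ x y ⟩
        T + coeff (List.map F p) x y   ≡⟨ cong (_+_ T) ih ⟩
        T + (At + Off)                 ≡⟨ swap T At Off ⟩
        At + (T + Off)                 ≡⟨ cong (_+_ At) (coeff-∷ (F t) _ x y) ⟨
        At + coeff (List.map F (t ∷ O)) x y ∎
        where
        open ≡-Reasoning
        T At Off : ℤ
        T = termCoeff (F t) x y
        At = coeff (List.map F A) x y
        Off = coeff (List.map F O) x y
        swap : ∀ u v w → u + (v + w) ≡ v + (u + w)
        swap = solve-∀

  coeff-map-partition : ∀ (F : Term n → Term n) a b p x y →
    coeff (List.map F p) x y ≡ coeff (List.map F (termsAt a b p)) x y + coeff (List.map F (termsOff a b p)) x y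
  coeff-map-partition F a b [] x y = refl
  coeff-map-partition F a b (t@(c , a' , b') ∷ p) x y with ≡-dec ℤ._≟_ a a' | ≡-dec ℤ._≟_ b b'
  ... | yes _ | yes _ = partition-hit  F t {p} {termsAt a b p} {termsOff a b p} x y (coeff-map-partition F a b p x y)
  ... | yes _ | no _  = partition-miss F t {p} {termsAt a b p} {termsOff a b p} x y (coeff-map-partition F a b p x y)
  ... | no _  | _     = partition-miss F t {p} {termsAt a b p} {termsOff a b p} x y (coeff-map-partition F a b p x y)

  coeff-partition : ∀ a b p x y → coeff p x y ≡ coeff (termsAt a b p) x y + coeff (termsOff a b p) x y
  coeff-partition a b p x y =
    trans (cong (λ q → coeff q x y) (sym (LP.map-id p)))
          (trans (coeff-map-partition (λ t → t) a b p x y)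
                 (cong₂ (λ u v → coeff u x y + coeff v x y) (LP.map-id (termsAt a b p)) (LP.map-id (termsOff a b p))))

  coeff-mapExponents-termsAt : ∀ f a b p x y →
    coeff (mapExponents f (termsAt a b p)) x y ≡ termCoeff (coeff p a b , f a b) x y
  coeff-mapExponents-termsAt f a b [] x y = sym (termCoeff-0 _ _ x y)
  coeff-mapExponents-termsAt f a b ((c , a' , b') ∷ p) x y with ≡-dec ℤ._≟_ a a' | ≡-dec ℤ._≟_ b b'
  ... | yes refl | yes refl = begin
    coeff ((c , f a b) ∷ mapExponents f (termsAt a b p)) x y
      ≡⟨ coeff-∷ (c , f a b) _ x y ⟩
    termCoeff (c , f a b) x y + coeff (mapExponents f (termsAt a b p)) x y
      ≡⟨ cong (_+_ (termCoeff (c , f a b) x y)) (coeff-mapExponents-termsAt f a b p x y) ⟩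
    termCoeff (c , f a b) x y + termCoeff (coeff p a b , f a b) x y
      ≡⟨ termCoeff-+ c (coeff p a b) _ _ x y ⟨
    termCoeff (c + coeff p a b , f a b) x y ∎
    where open ≡-Reasoning
  ... | yes _ | no _ = coeff-mapExponents-termsAt f a b p x y
  ... | no _  | _    = coeff-mapExponents-termsAt f a b p x y

  termsOff-length : ∀ a b p → length (termsOff a b p) ≤ length p
  termsOff-length a b [] = z≤n
  termsOff-length a b ((c , a' , b') ∷ p) with ≡-dec ℤ._≟_ a a' | ≡-dec ℤ._≟_ b b'
  ... | yes _ | yes _ = ℕP.m≤n⇒m≤1+n (termsOff-length a b p)
  ... | yes _ | no _  = s≤s (termsOff-length a b p)
  ... | no _  | _     = s≤s (termsOff-length a b p)

  termsOff-∷ : ∀ c a b p → termsOff a b ((c , a , b) ∷ p) ≡ termsOff a b p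
  termsOff-∷ c a b p with ≡-dec ℤ._≟_ a a | ≡-dec ℤ._≟_ b b
  ... | yes _   | yes _   = refl
  ... | yes _   | no b≢b  = ⊥-elim (b≢b refl)
  ... | no a≢a  | _       = ⊥-elim (a≢a refl)

  IsZero-termsOff : ∀ a b {p} → IsZero p → IsZero (termsOff a b p)
  IsZero-termsOff a b {p} zp x y = begin
    Off                                        ≡⟨ ℤP.+-identityˡ Off ⟨
    + 0 + Off                                  ≡⟨ cong (_+ Off) (termCoeff-0 a b x y) ⟨
    termCoeff (+ 0 , a , b) x y + Off          ≡⟨ cong (λ k → termCoeff (k , a , b) x y + Off) (zp a b) ⟨
    termCoeff (coeff p a b , a , b) x y + Off  ≡⟨ cong (_+ Off) (coeff-termsAt) ⟨
    coeff (termsAt a b p) x y + Off            ≡⟨ coeff-partition a b p x y ⟨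
    coeff p x y                                ≡⟨ zp x y ⟩
    + 0 ∎
    where
    open ≡-Reasoning
    Off : ℤ
    Off = coeff (termsOff a b p) x y
    coeff-termsAt : coeff (termsAt a b p) x y ≡ termCoeff (coeff p a b , a , b) x y
    coeff-termsAt = trans (cong (λ q → coeff q x y) (sym (LP.map-id (termsAt a b p))))
                          (coeff-mapExponents-termsAt _,_ a b p x y)

  -- Induction on the number of terms: all terms sharing the head's exponent cancel out and are mapped together.
  IsZero-mapExponents : ∀ f p → IsZero p → IsZero (mapExponents f p)
  IsZero-mapExponents f p = go (length p) p ℕP.≤-refl
    where
    go : ∀ k p → length p ≤ k → IsZero p → IsZero (mapExponents f p)
    go _ [] _ _ x y = refl
    go (suc k) p@((c , a , b) ∷ p') (s≤s |p'|≤k) zp x y = begin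
      coeff (mapExponents f p) x y
        ≡⟨ coeff-map-partition _ a b p x y ⟩
      coeff (mapExponents f (termsAt a b p)) x y + coeff (mapExponents f (termsOff a b p)) x y
        ≡⟨ cong₂ _+_ (coeff-mapExponents-termsAt f a b p x y) (go k (termsOff a b p) shorter (IsZero-termsOff a b zp) x y) ⟩
      termCoeff (coeff p a b , f a b) x y + + 0
        ≡⟨ cong (λ k → termCoeff (k , f a b) x y + + 0) (zp a b) ⟩
      termCoeff (+ 0 , f a b) x y + + 0
        ≡⟨ cong (_+ + 0) (termCoeff-0 _ _ x y) ⟩
      + 0 ∎
      where
      open ≡-Reasoning
      shorter : length (termsOff a b p) ≤ k
      shorter = subst (λ q → length q ≤ k) (sym (termsOff-∷ c a b p')) (ℕP.≤-trans (termsOff-length a b p') |p'|≤k)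

  mapExponents-⊖ : ∀ f p q → mapExponents f (p ⊖ q) ≡ mapExponents f p ⊖ mapExponents f q
  mapExponents-⊖ f p q = trans (LP.map-++ _ p (neg q)) (cong (mapExponents f p ++_)
    (trans (sym (LP.map-∘ q)) (trans (LP.map-cong (λ _ → refl) q) (LP.map-∘ q))))

  mapExponents-cong : ∀ f p q → p ≈ q → mapExponents f p ≈ mapExponents f q
  mapExponents-cong f p q p≈q = IsZero-⊖⇒≈ (mapExponents f p) (mapExponents f q)
    (subst IsZero (mapExponents-⊖ f p q) (IsZero-mapExponents f (p ⊖ q) (≈⇒IsZero-⊖ p q p≈q)))

-- y_a - y_b is not a zero divisor

module _ {n : ℕ} where

  coeff-ydiff-⊗ : ∀ (a b : Fin n) P x y → coeff ((ypow a (+ 1) ⊖ ypow b (+ 1)) ⊗ P) x y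
                    ≡ coeff P x (y −ᵥ unitᵥ a (+ 1)) - coeff P x (y −ᵥ unitᵥ b (+ 1))
  coeff-ydiff-⊗ a b P x y = begin
    coeff ((ypow a (+ 1) ⊖ ypow b (+ 1)) ⊗ P) x y
      ≡⟨ coeff-∷-⊗ (+ 1) zeroV (unitᵥ a (+ 1)) (mono -[1+ 0 ] zeroV (unitᵥ b (+ 1))) P x y ⟩
    + 1 * coeff P (x −ᵥ zeroV) (y −ᵥ unitᵥ a (+ 1)) + coeff (mono -[1+ 0 ] zeroV (unitᵥ b (+ 1)) ⊗ P) x y
      ≡⟨ cong (_+_ (+ 1 * coeff P (x −ᵥ zeroV) (y −ᵥ unitᵥ a (+ 1)))) (coeff-mono-⊗ -[1+ 0 ] zeroV (unitᵥ b (+ 1)) P x y) ⟩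
    + 1 * coeff P (x −ᵥ zeroV) (y −ᵥ unitᵥ a (+ 1)) + -[1+ 0 ] * coeff P (x −ᵥ zeroV) (y −ᵥ unitᵥ b (+ 1))
      ≡⟨ cong (λ x' → + 1 * coeff P x' (y −ᵥ unitᵥ a (+ 1)) + -[1+ 0 ] * coeff P x' (y −ᵥ unitᵥ b (+ 1))) (−ᵥ-identityʳ x) ⟩
    + 1 * coeff P x (y −ᵥ unitᵥ a (+ 1)) + -[1+ 0 ] * coeff P x (y −ᵥ unitᵥ b (+ 1))
      ≡⟨ normalise (coeff P x (y −ᵥ unitᵥ a (+ 1))) (coeff P x (y −ᵥ unitᵥ b (+ 1))) ⟩
    coeff P x (y −ᵥ unitᵥ a (+ 1)) - coeff P x (y −ᵥ unitᵥ b (+ 1)) ∎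
    where
    open ≡-Reasoning
    normalise : ∀ u v → + 1 * u + -[1+ 0 ] * v ≡ u - v
    normalise = solve-∀

  distanceAt : Fin n → Vec ℤ n → Laurent n → ℕ
  distanceAt a z [] = 0
  distanceAt a z ((_ , _ , b) ∷ p) = ∣ lookup b a - lookup z a ∣ ℕ.+ distanceAt a z p

  coeff-beyond-distanceAt : ∀ a z k p x w → lookup w a ≡ lookup z a + + k → distanceAt a z p < k → coeff p x w ≡ + 0
  coeff-beyond-distanceAt a z k [] x w wₐ≡ far = refl
  coeff-beyond-distanceAt a z k ((c , a' , b') ∷ p) x w wₐ≡ far = begin
    coeff ((c , a' , b') ∷ p) x w              ≡⟨ coeff-∷ (c , a' , b') p x w ⟩
    termCoeff (c , a' , b') x w + coeff p x w  ≡⟨ cong₂ _+_ (termCoeff-≢ c {a'} {b'} {x} λ (_ , w≡b') → w≢b' w≡b')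
                                                       (coeff-beyond-distanceAt a z k p x w wₐ≡ (ℕP.≤-<-trans (ℕP.m≤n+m _ _) far)) ⟩
    + 0 ∎
    where
    open ≡-Reasoning
    w≢b' : w ≢ b'
    w≢b' refl = ℕP.<-irrefl distance≡k (ℕP.≤-<-trans (ℕP.m≤m+n _ _) far)
      where
      cancel : ∀ u v → u + v - u ≡ v
      cancel = solve-∀
      distance≡k : ∣ lookup w a - lookup z a ∣ ≡ k
      distance≡k = cong ∣_∣ (trans (cong (_- lookup z a) wₐ≡) (cancel (lookup z a) (+ k)))

  -- (y_a - y_b) P = 0 makes the coefficients of P invariant under the exponent shift y ↦ y + e_a - e_b;
  -- shifting far enough in direction a leaves the finite support of P.
  IsZero-cancel-ydiff : ∀ {a b : Fin n} → a ≢ b → ∀ P → IsZero ((ypow a (+ 1) ⊖ ypow b (+ 1)) ⊗ P) → IsZero P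
  IsZero-cancel-ydiff {a} {b} a≢b P z x y = trans (shifts-preserve-coeff k) (coeff-beyond-distanceAt a y k P x (shifts k) (lookup-shifts k) ℕP.≤-refl)
    where
    eₐ e_b : Vec ℤ n
    eₐ = unitᵥ a (+ 1)
    e_b = unitᵥ b (+ 1)
    k : ℕ
    k = suc (distanceAt a y P)

    shifts : ℕ → Vec ℤ n
    shifts zero = y
    shifts (suc m) = (shifts m +ᵥ eₐ) −ᵥ e_b

    shifts-preserve-coeff : ∀ m → coeff P x y ≡ coeff P x (shifts m)
    shifts-preserve-coeff zero = refl
    shifts-preserve-coeff (suc m) = begin
      coeff P x y                           ≡⟨ shifts-preserve-coeff m ⟩
      coeff P x (shifts m)                  ≡⟨ cong (coeff P x) (+ᵥ-−ᵥ-cancel (shifts m) eₐ) ⟨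
      coeff P x ((shifts m +ᵥ eₐ) −ᵥ eₐ)     ≡⟨ ℤP.i-j≡0⇒i≡j _ _ (trans (sym (coeff-ydiff-⊗ a b P x (shifts m +ᵥ eₐ))) (z x _)) ⟩
      coeff P x (shifts (suc m)) ∎
      where open ≡-Reasoning

    lookup-shifts : ∀ m → lookup (shifts m) a ≡ lookup y a + + m
    lookup-shifts zero = sym (ℤP.+-identityʳ _)
    lookup-shifts (suc m) = begin
      lookup ((shifts m +ᵥ eₐ) −ᵥ e_b) a               ≡⟨ lookup-−ᵥ (shifts m +ᵥ eₐ) e_b a ⟩
      lookup (shifts m +ᵥ eₐ) a - lookup e_b a          ≡⟨ cong₂ _-_ (lookup-+ᵥ (shifts m) eₐ a) (lookup-unitᵥ-≢ (+ 1) a≢b) ⟩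
      lookup (shifts m) a + lookup eₐ a - + 0           ≡⟨ cong₂ (λ u v → u + v - + 0) (lookup-shifts m) (VP.lookup∘update a zeroV (+ 1)) ⟩
      lookup y a + + m + + 1 - + 0                      ≡⟨ normalise (lookup y a) (+ m) ⟩
      lookup y a + (+ 1 + + m) ∎
      where
      open ≡-Reasoning
      normalise : ∀ u v → u + v + + 1 - + 0 ≡ u + (+ 1 + v)
      normalise = solve-∀

module _ {n : ℕ} where

  transpose-matchˡ : ∀ (k l : Fin n) → PC.transpose k l k ≡ l
  transpose-matchˡ k l with k Fin.≟ k
  ... | yes _   = refl
  ... | no k≢k  = ⊥-elim (k≢k refl)

  transpose-matchʳ : ∀ (k l : Fin n) → PC.transpose k l l ≡ k
  transpose-matchʳ k l with l Fin.≟ k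
  ... | yes refl = refl
  ... | no _ with l Fin.≟ l
  ...   | yes _  = refl
  ...   | no l≢l = ⊥-elim (l≢l refl)

  transpose-other : ∀ {k l j : Fin n} → j ≢ k → j ≢ l → PC.transpose k l j ≡ j
  transpose-other {k} {l} {j} j≢k j≢l with j Fin.≟ k
  ... | yes j≡k = ⊥-elim (j≢k j≡k)
  ... | no _ with j Fin.≟ l
  ...   | yes j≡l = ⊥-elim (j≢l j≡l)
  ...   | no _    = refl

  transpose-involutive : ∀ (k l j : Fin n) → PC.transpose k l (PC.transpose k l j) ≡ j
  transpose-involutive k l j = by-cases (j Fin.≟ k) (j Fin.≟ l)
    where
    by-cases : Dec (j ≡ k) → Dec (j ≡ l) → PC.transpose k l (PC.transpose k l j) ≡ j
    by-cases (yes refl) _          = trans (cong (PC.transpose j l) (transpose-matchˡ j l)) (transpose-matchʳ j l)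
    by-cases (no _)     (yes refl) = trans (cong (PC.transpose k j) (transpose-matchʳ k j)) (transpose-matchˡ k j)
    by-cases (no j≢k)   (no j≢l)   = trans (cong (PC.transpose k l) (transpose-other j≢k j≢l)) (transpose-other j≢k j≢l)

module FinSum (M : CommutativeMonoid 0ℓ 0ℓ) where

  open CommutativeMonoid M
    using (Carrier; ∙-congˡ; ∙-congʳ; identityˡ; identityʳ)
    renaming (_≈_ to _≈ₘ_; _∙_ to _⊕ₘ_; ε to 0#; trans to ≈-trans; sym to ≈-sym)
  open Sum M public using (sum; ∑-distrib-+; sum-cong-≗; sum-cong-≋; sum-permute; sum-replicate-zero)

  sum-zero : ∀ {m} (f : Fin m → Carrier) → (∀ j → f j ≈ₘ 0#) → sum f ≈ₘ 0#
  sum-zero {m} f f≈0 = ≈-trans (sum-cong-≋ f≈0) (sum-replicate-zero m)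

  sum-single : ∀ {m} (f : Fin m → Carrier) k → (∀ j → j ≢ k → f j ≈ₘ 0#) → sum f ≈ₘ f k
  sum-single f Fin.zero    f≈0 = ≈-trans (∙-congˡ (sum-zero (f ∘ Fin.suc) λ j → f≈0 (Fin.suc j) λ ())) (identityʳ _)
  sum-single f (Fin.suc k) f≈0 = ≈-trans (∙-congʳ (f≈0 Fin.zero λ ()))
    (≈-trans (identityˡ _) (sum-single (f ∘ Fin.suc) k λ j j≢k → f≈0 (Fin.suc j) (j≢k ∘ FP.suc-injective)))

  sum-transpose : ∀ {m} (f : Fin m → Carrier) k l → sum (f ∘ PC.transpose k l) ≈ₘ sum f
  sum-transpose f k l = ≈-sym (sum-permute f (Perm.transpose k l))

  foldr-tabulate : ∀ {A : Set} {m} (g : A → Carrier) (f : Fin m → A) →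
    List.foldr (λ x s → g x ⊕ₘ s) 0# (List.tabulate f) ≡ sum (g ∘ f)
  foldr-tabulate {m = zero}  g f = refl
  foldr-tabulate {m = suc m} g f = cong (g (f Fin.zero) ⊕ₘ_) (foldr-tabulate g (f ∘ Fin.suc))

module ℤΣ = FinSum ℤP.+-0-commutativeMonoid
module ℕΣ = FinSum ℕP.+-0-commutativeMonoid

-- Specialization x ↦ y_v

module _ {n : ℕ} where

  lookup-swapVec : ∀ {A : Set} (k l j : Fin n) (xs : Vec A n) → lookup (swapVec k l xs) j ≡ lookup xs (PC.transpose k l j)
  lookup-swapVec k l j xs = by-cases (j Fin.≟ l) (j Fin.≟ k)
    where
    by-cases : Dec (j ≡ l) → Dec (j ≡ k) → lookup (swapVec k l xs) j ≡ lookup xs (PC.transpose k l j)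
    by-cases (yes refl) _ = trans (VP.lookup∘update j (xs [ k ]≔ lookup xs j) (lookup xs k)) (cong (lookup xs) (sym (transpose-matchʳ k j)))
    by-cases (no j≢l) (yes refl) = begin
      lookup ((xs [ j ]≔ lookup xs l) [ l ]≔ lookup xs j) j ≡⟨ VP.lookup∘update′ j≢l (xs [ j ]≔ lookup xs l) (lookup xs j) ⟩
      lookup (xs [ j ]≔ lookup xs l) j                      ≡⟨ VP.lookup∘update j xs (lookup xs l) ⟩
      lookup xs l                                           ≡⟨ cong (lookup xs) (transpose-matchˡ j l) ⟨
      lookup xs (PC.transpose j l j) ∎
      where open ≡-Reasoning
    by-cases (no j≢l) (no j≢k) = begin
      lookup ((xs [ k ]≔ lookup xs l) [ l ]≔ lookup xs k) j ≡⟨ VP.lookup∘update′ j≢l (xs [ k ]≔ lookup xs l) (lookup xs k) ⟩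
      lookup (xs [ k ]≔ lookup xs l) j                      ≡⟨ VP.lookup∘update′ j≢k xs (lookup xs l) ⟩
      lookup xs j                                           ≡⟨ cong (lookup xs) (transpose-other j≢k j≢l) ⟨
      lookup xs (PC.transpose k l j) ∎
      where open ≡-Reasoning

  swapVec-involutive : ∀ {A : Set} (k l : Fin n) (xs : Vec A n) → swapVec k l (swapVec k l xs) ≡ xs
  swapVec-involutive k l xs = Pointwise-≡⇒≡ (ext λ j → begin
    lookup (swapVec k l (swapVec k l xs)) j          ≡⟨ lookup-swapVec k l j (swapVec k l xs) ⟩
    lookup (swapVec k l xs) (PC.transpose k l j)     ≡⟨ lookup-swapVec k l _ xs ⟩
    lookup xs (PC.transpose k l (PC.transpose k l j)) ≡⟨ cong (lookup xs) (transpose-involutive k l j) ⟩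
    lookup xs j ∎)
    where open ≡-Reasoning

  -- specExp v a b = b + v_* a: the exponent of y_m collects the exponents a_j with v(j) ≡ m.
  fiberTerm : OneLine n → Vec ℤ n → Fin n → Fin n → ℤ
  fiberTerm v a m j with lookup v j Fin.≟ m
  ... | yes _ = lookup a j
  ... | no _  = + 0

  lookup-specExp : ∀ v a b m → lookup (specExp v a b) m ≡ lookup b m + ℤΣ.sum (fiberTerm v a m)
  lookup-specExp v a b m = trans (lookup-foldr (allFin n)) (cong (_+_ (lookup b m)) (ℤΣ.foldr-tabulate (fiberTerm v a m) (λ j → j)))
    where
    step : Fin n → Vec ℤ n → Vec ℤ n
    step j acc = acc [ lookup v j ]%= (_+_ (lookup a j))
    lookup-foldr : ∀ js → lookup (List.foldr step b js) m ≡ lookup b m + List.foldr (λ j s → fiberTerm v a m j + s) (+ 0) js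
    lookup-foldr [] = sym (ℤP.+-identityʳ _)
    lookup-foldr (j ∷ js) with lookup v j Fin.≟ m
    ... | yes refl = trans (VP.lookup∘updateAt (lookup v j) (List.foldr step b js))
                          (trans (cong (_+_ (lookup a j)) (lookup-foldr js)) (swap (lookup a j) (lookup b (lookup v j)) _))
      where
      swap : ∀ x y z → x + (y + z) ≡ y + (x + z)
      swap = solve-∀
    ... | no vj≢m = trans (VP.lookup∘updateAt′ m (lookup v j) (vj≢m ∘ sym) (List.foldr step b js))
                         (trans (lookup-foldr js) (cong (_+_ (lookup b m)) (sym (ℤP.+-identityˡ _))))

  specExp-+ : ∀ v a a' b b' → specExp v (a +ᵥ a') (b +ᵥ b') ≡ specExp v a b +ᵥ specExp v a' b'
  specExp-+ v a a' b b' = pointwise λ m → begin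
    lookup (specExp v (a +ᵥ a') (b +ᵥ b')) m
      ≡⟨ lookup-specExp v (a +ᵥ a') (b +ᵥ b') m ⟩
    lookup (b +ᵥ b') m + ℤΣ.sum (fiberTerm v (a +ᵥ a') m)
      ≡⟨ cong₂ _+_ (lookup-+ᵥ b b' m) (trans (ℤΣ.sum-cong-≗ (fiberTerm-+ m)) (ℤΣ.∑-distrib-+ (fiberTerm v a m) (fiberTerm v a' m))) ⟩
    (lookup b m + lookup b' m) + (ℤΣ.sum (fiberTerm v a m) + ℤΣ.sum (fiberTerm v a' m))
      ≡⟨ interchange (lookup b m) (lookup b' m) _ _ ⟩
    (lookup b m + ℤΣ.sum (fiberTerm v a m)) + (lookup b' m + ℤΣ.sum (fiberTerm v a' m))
      ≡⟨ cong₂ _+_ (lookup-specExp v a b m) (lookup-specExp v a' b' m) ⟨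
    lookup (specExp v a b) m + lookup (specExp v a' b') m
      ≡⟨ lookup-+ᵥ (specExp v a b) (specExp v a' b') m ⟨
    lookup (specExp v a b +ᵥ specExp v a' b') m ∎
    where
    open ≡-Reasoning
    interchange : ∀ w x y z → (w + x) + (y + z) ≡ (w + y) + (x + z)
    interchange = solve-∀
    fiberTerm-+ : ∀ m j → fiberTerm v (a +ᵥ a') m j ≡ fiberTerm v a m j + fiberTerm v a' m j
    fiberTerm-+ m j with lookup v j Fin.≟ m
    ... | yes _ = lookup-+ᵥ a a' j
    ... | no _  = refl

  specExp-zeroˡ : ∀ v b → specExp v zeroV b ≡ b
  specExp-zeroˡ v b = pointwise λ m → begin
    lookup (specExp v zeroV b) m               ≡⟨ lookup-specExp v zeroV b m ⟩
    lookup b m + ℤΣ.sum (fiberTerm v zeroV m)  ≡⟨ cong (_+_ (lookup b m)) (ℤΣ.sum-zero _ (fiberTerm-zero m)) ⟩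
    lookup b m + + 0                           ≡⟨ ℤP.+-identityʳ _ ⟩
    lookup b m ∎
    where
    open ≡-Reasoning
    fiberTerm-zero : ∀ m j → fiberTerm v zeroV m j ≡ + 0
    fiberTerm-zero m j with lookup v j Fin.≟ m
    ... | yes _ = lookup-zeroV j
    ... | no _  = refl

  specExp-unitᵥ : ∀ v k e → specExp v (unitᵥ k e) zeroV ≡ unitᵥ (lookup v k) e
  specExp-unitᵥ v k e = pointwise λ m → begin
    lookup (specExp v (unitᵥ k e) zeroV) m                    ≡⟨ lookup-specExp v (unitᵥ k e) zeroV m ⟩
    lookup zeroV m + ℤΣ.sum (fiberTerm v (unitᵥ k e) m)       ≡⟨ cong₂ _+_ (lookup-zeroV m) (ℤΣ.sum-single _ k (fiberTerm-off m)) ⟩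
    + 0 + fiberTerm v (unitᵥ k e) m k                         ≡⟨ ℤP.+-identityˡ _ ⟩
    fiberTerm v (unitᵥ k e) m k                               ≡⟨ fiberTerm-at m ⟩
    lookup (unitᵥ (lookup v k) e) m ∎
    where
    open ≡-Reasoning
    fiberTerm-off : ∀ m j → j ≢ k → fiberTerm v (unitᵥ k e) m j ≡ + 0
    fiberTerm-off m j j≢k with lookup v j Fin.≟ m
    ... | yes _ = lookup-unitᵥ-≢ e j≢k
    ... | no _  = refl
    fiberTerm-at : ∀ m → fiberTerm v (unitᵥ k e) m k ≡ lookup (unitᵥ (lookup v k) e) m
    fiberTerm-at m with lookup v k Fin.≟ m
    ... | yes refl = trans (VP.lookup∘update k zeroV e) (sym (VP.lookup∘update (lookup v k) zeroV e))
    ... | no vk≢m  = sym (lookup-unitᵥ-≢ e (vk≢m ∘ sym))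

  specExp-swapVec : ∀ v k l a b → specExp v (swapVec k l a) b ≡ specExp (swapVec k l v) a b
  specExp-swapVec v k l a b = pointwise λ m → begin
    lookup (specExp v (swapVec k l a) b) m                 ≡⟨ lookup-specExp v (swapVec k l a) b m ⟩
    lookup b m + ℤΣ.sum (fiberTerm v (swapVec k l a) m)    ≡⟨ cong (_+_ (lookup b m)) (ℤΣ.sum-cong-≗ (fiberTerm-swap m)) ⟩
    lookup b m + ℤΣ.sum (fiberTerm (swapVec k l v) a m ∘ τ) ≡⟨ cong (_+_ (lookup b m)) (ℤΣ.sum-transpose _ k l) ⟩
    lookup b m + ℤΣ.sum (fiberTerm (swapVec k l v) a m)    ≡⟨ lookup-specExp (swapVec k l v) a b m ⟨
    lookup (specExp (swapVec k l v) a b) m ∎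
    where
    open ≡-Reasoning
    τ = PC.transpose k l
    v∘τ∘τ : ∀ j → lookup (swapVec k l v) (τ j) ≡ lookup v j
    v∘τ∘τ j = trans (lookup-swapVec k l (τ j) v) (cong (lookup v) (transpose-involutive k l j))
    fiberTerm-swap : ∀ m j → fiberTerm v (swapVec k l a) m j ≡ fiberTerm (swapVec k l v) a m (τ j)
    fiberTerm-swap m j with lookup v j Fin.≟ m | lookup (swapVec k l v) (τ j) Fin.≟ m
    ... | yes _    | yes _    = lookup-swapVec k l j a
    ... | no _     | no _     = refl
    ... | yes vj≡m | no vτj≢m = ⊥-elim (vτj≢m (trans (v∘τ∘τ j) vj≡m))
    ... | no vj≢m  | yes vτj≡m = ⊥-elim (vj≢m (trans (sym (v∘τ∘τ j)) vτj≡m))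

  specializeTerm : OneLine n → Term n → Term n
  specializeTerm v (c , a , b) = c , zeroV , specExp v a b

  specialize-⊗ : ∀ v p q → specialize v (p ⊗ q) ≡ specialize v p ⊗ specialize v q
  specialize-⊗ v [] q = refl
  specialize-⊗ v ((c , a , b) ∷ p) q = begin
    specialize v (List.map ((c , a , b) ·ₜ_) q ++ p ⊗ q)
      ≡⟨ LP.map-++ _ (List.map ((c , a , b) ·ₜ_) q) (p ⊗ q) ⟩
    specialize v (List.map ((c , a , b) ·ₜ_) q) ++ specialize v (p ⊗ q)
      ≡⟨ cong₂ _++_ (trans (sym (LP.map-∘ q)) (trans (LP.map-cong specialize-· q) (LP.map-∘ q))) (specialize-⊗ v p q) ⟩
    List.map ((c , zeroV , specExp v a b) ·ₜ_) (specialize v q) ++ specialize v p ⊗ specialize v q ∎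
    where
    open ≡-Reasoning
    specialize-· : ∀ t → specializeTerm v ((c , a , b) ·ₜ t) ≡ specializeTerm v (c , a , b) ·ₜ specializeTerm v t
    specialize-· (d , a' , b') = cong (λ E → c * d , E) (cong₂ _,_ (sym (+ᵥ-identityˡ zeroV)) (specExp-+ v a a' b b'))

  specialize-⊖ : ∀ (v : OneLine n) p q → specialize v (p ⊖ q) ≡ specialize v p ⊖ specialize v q
  specialize-⊖ v = mapExponents-⊖ (λ a b → zeroV , specExp v a b)

  specialize-cong : ∀ (v : OneLine n) p q → p ≈ q → specialize v p ≈ specialize v q
  specialize-cong v = mapExponents-cong (λ a b → zeroV , specExp v a b)

  specialize-xpow : ∀ v k e → specialize v (xpow k e) ≡ ypow (lookup v k) e
  specialize-xpow v k e = cong (mono (+ 1) zeroV) (specExp-unitᵥ v k e)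

  specialize-ypow : ∀ v k e → specialize v (ypow k e) ≡ ypow k e
  specialize-ypow v k e = cong (mono (+ 1) zeroV) (specExp-zeroˡ v _)

  specialize-one : ∀ v → specialize v one ≡ one
  specialize-one v = cong (mono (+ 1) zeroV) (specExp-zeroˡ v _)

  specialize-swapX : ∀ v k l p → specialize v (swapX k l p) ≡ specialize (swapVec k l v) p
  specialize-swapX v k l p = trans (sym (LP.map-∘ p)) (LP.map-cong (λ (c , a , b) → cong (λ b' → c , zeroV , b') (specExp-swapVec v k l a b)) p)

  specialize-prodL : ∀ v L → specialize v (prodL L) ≡ prodL (List.map (specialize v) L)
  specialize-prodL v []      = specialize-one v
  specialize-prodL v (p ∷ L) = trans (specialize-⊗ v p (prodL L)) (cong (specialize v p ⊗_) (specialize-prodL v L))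

⌊⌋-true : ∀ {A : Set} (a? : Dec A) → A → ⌊ a? ⌋ ≡ true
⌊⌋-true a? a = trans (isYes≗does a?) (dec-true a? a)

⌊⌋-false : ∀ {A : Set} (a? : Dec A) → ¬ A → ⌊ a? ⌋ ≡ false
⌊⌋-false a? ¬a = trans (isYes≗does a?) (dec-false a? ¬a)

⌊⌋-⇔ : ∀ {A B : Set} (a? : Dec A) (b? : Dec B) → (A → B) → (B → A) → ⌊ a? ⌋ ≡ ⌊ b? ⌋
⌊⌋-⇔ a? b? f g = trans (isYes≗does a?) (trans (does-⇔ (mk⇔ f g) a? b?) (sym (isYes≗does b?)))

indicator : Bool → ℕ
indicator b = if b then 1 else 0

sum-map-concatMap : ∀ {A B : Set} (f : B → ℕ) (g : A → List B) xs →
  ℕL.sum (List.map f (concatMap g xs)) ≡ List.foldr (λ x s → ℕL.sum (List.map f (g x)) ℕ.+ s) 0 xs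
sum-map-concatMap f g []       = refl
sum-map-concatMap f g (x ∷ xs) = begin
  ℕL.sum (List.map f (g x ++ concatMap g xs))                  ≡⟨ cong ℕL.sum (LP.map-++ f (g x) (concatMap g xs)) ⟩
  ℕL.sum (List.map f (g x) ++ List.map f (concatMap g xs))     ≡⟨ ℕLP.sum-++ (List.map f (g x)) _ ⟩
  ℕL.sum (List.map f (g x)) ℕ.+ ℕL.sum (List.map f (concatMap g xs)) ≡⟨ cong (ℕL.sum (List.map f (g x)) ℕ.+_) (sum-map-concatMap f g xs) ⟩
  ℕL.sum (List.map f (g x)) ℕ.+ List.foldr (λ x s → ℕL.sum (List.map f (g x)) ℕ.+ s) 0 xs ∎
  where open ≡-Reasoning

module _ {n : ℕ} where

  inversion : OneLine n → Fin n → Fin n → ℕ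
  inversion w p q = indicator (⌊ p Fin.<? q ⌋ ∧ ⌊ lookup w q Fin.<? lookup w p ⌋)

  len-as-sum : ∀ w → len w ≡ ℕΣ.sum (λ p → ℕΣ.sum (inversion w p))
  len-as-sum w = begin
    ℕL.sum (List.map I (pairs n))
      ≡⟨ sum-map-concatMap I (λ p → List.map (p ,_) (allFin n)) (allFin n) ⟩
    List.foldr (λ p s → ℕL.sum (List.map I (List.map (p ,_) (allFin n))) ℕ.+ s) 0 (allFin n)
      ≡⟨ ℕΣ.foldr-tabulate (λ p → ℕL.sum (List.map I (List.map (p ,_) (allFin n)))) (λ p → p) ⟩
    ℕΣ.sum (λ p → ℕL.sum (List.map I (List.map (p ,_) (allFin n))))
      ≡⟨ ℕΣ.sum-cong-≗ row ⟩
    ℕΣ.sum (λ p → ℕΣ.sum (inversion w p)) ∎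
    where
    open ≡-Reasoning
    I : Fin n × Fin n → ℕ
    I (p , q) = inversion w p q
    row : ∀ p → ℕL.sum (List.map I (List.map (p ,_) (allFin n))) ≡ ℕΣ.sum (inversion w p)
    row p = begin
      ℕL.sum (List.map I (List.map (p ,_) (allFin n)))      ≡⟨ cong ℕL.sum (LP.map-∘ (allFin n)) ⟨
      ℕL.sum (List.map (inversion w p) (allFin n))          ≡⟨ LP.foldr-map ℕ._+_ (inversion w p) 0 (allFin n) ⟩
      List.foldr (λ q s → inversion w p q ℕ.+ s) 0 (allFin n) ≡⟨ ℕΣ.foldr-tabulate (inversion w p) (λ q → q) ⟩
      ℕΣ.sum (inversion w p) ∎

IsPerm⇒injective : ∀ {n} (w : OneLine n) → IsPerm w → Injective _≡_ _≡_ (lookup w)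
IsPerm⇒injective {zero}  w perm {()}
IsPerm⇒injective {suc m} w perm {j} {j'} wj≡wj' with j Fin.≟ j'
... | yes j≡j' = j≡j'
... | no j≢j'  = ⊥-elim (ℕP.<-irrefl refl (FP.injective⇒≤ {f = f} f-injective))
  where
  -- Because w j ≡ w j', the section of w can be redirected away from j'; it then injects Fin (suc m) into Fin m.
  section : Fin (suc m) → Fin (suc m)
  section k with proj₁ (perm k) Fin.≟ j'
  ... | yes _ = j
  ... | no _  = proj₁ (perm k)

  w∘section : ∀ k → lookup w (section k) ≡ k
  w∘section k with proj₁ (perm k) Fin.≟ j'
  ... | yes refl = trans wj≡wj' (proj₂ (perm k))
  ... | no _     = proj₂ (perm k)

  section≢j' : ∀ k → j' ≢ section k
  section≢j' k with proj₁ (perm k) Fin.≟ j'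
  ... | yes _   = j≢j' ∘ sym
  ... | no s≢j' = s≢j' ∘ sym

  f : Fin (suc m) → Fin m
  f k = Fin.punchOut (section≢j' k)

  f-injective : Injective _≡_ _≡_ f
  f-injective {k} {k'} fk≡fk' = begin
    k                        ≡⟨ w∘section k ⟨
    lookup w (section k)     ≡⟨ cong (lookup w) (FP.punchOut-injective (section≢j' k) (section≢j' k') fk≡fk') ⟩
    lookup w (section k')    ≡⟨ w∘section k' ⟩
    k' ∎
    where open ≡-Reasoning

module _ {n : ℕ} where

  len≤length-pairs : ∀ (w : OneLine n) → len w ≤ length (pairs n)
  len≤length-pairs w = bound (pairs n)
    where
    bound : ∀ ps → ℕL.sum (List.map (λ (p , q) → inversion w p q) ps) ≤ length ps
    bound []             = z≤n
    bound ((p , q) ∷ ps) = ℕP.+-mono-≤ (indicator≤1 _) (bound ps)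
      where
      indicator≤1 : ∀ b → indicator b ≤ 1
      indicator≤1 true  = ℕP.≤-refl
      indicator≤1 false = z≤n

-- Rank counts and the Bruhat order

atLeast : ℕ → ℕ → ℕ
atLeast Q x = indicator ⌊ Q ℕ.≤? x ⌋

atLeast-≤ : ∀ Q x → Q ≤ x → atLeast Q x ≡ 1
atLeast-≤ Q x Q≤x = cong indicator (⌊⌋-true (Q ℕ.≤? x) Q≤x)

atLeast-≰ : ∀ Q x → ¬ Q ≤ x → atLeast Q x ≡ 0
atLeast-≰ Q x Q≰x = cong indicator (⌊⌋-false (Q ℕ.≤? x) Q≰x)

atLeast-mono : ∀ Q {x y} → x ≤ y → atLeast Q x ≤ atLeast Q y
atLeast-mono Q {x} {y} x≤y with Q ℕ.≤? x
... | no Q≰x  = z≤n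
... | yes Q≤x = ℕP.≤-reflexive (sym (atLeast-≤ Q y (ℕP.≤-trans Q≤x x≤y)))

module _ {n : ℕ} where

  -- w(P) as a number, with junk value 0 outside 0 ≤ P < n
  entry : OneLine n → ℕ → ℕ
  entry w P with P ℕ.<? n
  ... | yes P<n = toℕ (lookup w (fromℕ< P<n))
  ... | no _    = 0

  entry-<n : ∀ w {P} (P<n : P < n) → entry w P ≡ toℕ (lookup w (fromℕ< P<n))
  entry-<n w {P} P<n with P ℕ.<? n
  ... | yes P<n′ = cong (toℕ ∘ lookup w) (FP.fromℕ<-cong P P refl P<n′ P<n)
  ... | no P≮n   = ⊥-elim (P≮n P<n)

  entry-toℕ : ∀ w (k : Fin n) → entry w (toℕ k) ≡ toℕ (lookup w k)
  entry-toℕ w k = trans (entry-<n w (FP.toℕ<n k)) (cong (toℕ ∘ lookup w) (FP.fromℕ<-toℕ k (FP.toℕ<n k)))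

  entry-≮n : ∀ w {P} → ¬ P < n → entry w P ≡ 0
  entry-≮n w {P} P≮n with P ℕ.<? n
  ... | yes P<n = ⊥-elim (P≮n P<n)
  ... | no _    = refl

  -- rank w P Q = #{p < P | Q ≤ w(p)}; w ≤ v in the Bruhat order iff rank w ≤ rank v everywhere.
  rank : OneLine n → ℕ → ℕ → ℕ
  rank w zero    Q = 0
  rank w (suc P) Q = rank w P Q ℕ.+ atLeast Q (entry w P)

  NotBelow : OneLine n → OneLine n → Set
  NotBelow w v = ∃[ P ] ∃[ Q ] rank v P Q < rank w P Q

  rank-mono : ∀ w v → (∀ P → entry w P ≤ entry v P) → ∀ P Q → rank w P Q ≤ rank v P Q
  rank-mono w v w≤v zero    Q = z≤n
  rank-mono w v w≤v (suc P) Q = ℕP.+-mono-≤ (rank-mono w v w≤v P Q) (atLeast-mono Q (w≤v P))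

  rank-separates : ∀ w v P Q → rank v (suc P) Q < rank w (suc P) Q → rank w P Q ≤ rank v P Q →
    rank v P Q ≡ rank w P Q × Q ≤ entry w P × ¬ Q ≤ entry v P
  rank-separates w v P Q v<w w≤v with Q ℕ.≤? entry w P | Q ℕ.≤? entry v P
  ... | no _     | _        = ⊥-elim (ℕP.<⇒≱ v<w (ℕP.≤-trans (ℕP.≤-reflexive (ℕP.+-identityʳ _)) (ℕP.≤-trans w≤v (ℕP.m≤m+n _ _))))
  ... | yes _    | yes _    = ⊥-elim (ℕP.<⇒≱ v<w (ℕP.+-monoˡ-≤ 1 w≤v))
  ... | yes Q≤wP | no Q≰vP  = ℕP.≤-antisym v≤w w≤v , Q≤wP , Q≰vP
    where
    v≤w : rank v P Q ≤ rank w P Q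
    v≤w = ℕP.≤-pred (subst₂ _<_ (ℕP.+-identityʳ _) (ℕP.+-comm _ 1) v<w)

-- Adjacent transpositions

module AdjacentTransposition {n : ℕ} (i : ℕ) (h : suc i < n) where

  K L : Fin n
  K = pos i h
  L = pos+1 i h

  toℕ-K : toℕ K ≡ i
  toℕ-K = FP.toℕ-fromℕ< _

  toℕ-L : toℕ L ≡ suc i
  toℕ-L = FP.toℕ-fromℕ< _

  K<L : K Fin.< L
  K<L = subst₂ ℕ._<_ (sym toℕ-K) (sym toℕ-L) (ℕP.n<1+n i)

  K≢L : K ≢ L
  K≢L K≡L = ℕP.<-irrefl (cong toℕ K≡L) K<L

  ≢K⇒toℕ≢ : ∀ {p} → p ≢ K → toℕ p ≢ i
  ≢K⇒toℕ≢ p≢K e = p≢K (FP.toℕ-injective (trans e (sym toℕ-K)))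

  ≢L⇒toℕ≢ : ∀ {p} → p ≢ L → toℕ p ≢ suc i
  ≢L⇒toℕ≢ p≢L e = p≢L (FP.toℕ-injective (trans e (sym toℕ-L)))

  τ : Fin n → Fin n
  τ = PC.transpose K L

  τ-K : τ K ≡ L
  τ-K = transpose-matchˡ K L

  τ-L : τ L ≡ K
  τ-L = transpose-matchʳ K L

  τ-involutive : ∀ j → τ (τ j) ≡ j
  τ-involutive = transpose-involutive K L

  lookup-rightMulS : ∀ w j → lookup (rightMulS w i h) j ≡ lookup w (τ j)
  lookup-rightMulS w j = lookup-swapVec K L j w

  rightMulS-K : ∀ w → lookup (rightMulS w i h) K ≡ lookup w L
  rightMulS-K w = trans (lookup-rightMulS w K) (cong (lookup w) τ-K)

  rightMulS-L : ∀ w → lookup (rightMulS w i h) L ≡ lookup w K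
  rightMulS-L w = trans (lookup-rightMulS w L) (cong (lookup w) τ-L)

  rightMulS-involutive : ∀ w → rightMulS (rightMulS w i h) i h ≡ w
  rightMulS-involutive = swapVec-involutive K L

  τ-preserves-< : ∀ {p q} → p Fin.< q → ¬ (p ≡ K × q ≡ L) → τ p Fin.< τ q
  τ-preserves-< {p} {q} p<q ¬KL = by-cases (p Fin.≟ K) (p Fin.≟ L) (q Fin.≟ K) (q Fin.≟ L)
    where
    by-cases : Dec (p ≡ K) → Dec (p ≡ L) → Dec (q ≡ K) → Dec (q ≡ L) → τ p Fin.< τ q
    by-cases (yes refl) _ (yes refl) _ = ⊥-elim (ℕP.<-irrefl refl p<q)
    by-cases (yes refl) _ _ (yes refl) = ⊥-elim (¬KL (refl , refl))
    by-cases (yes refl) _ (no q≢K) (no q≢L) = subst₂ Fin._<_ (sym τ-K) (sym (transpose-other q≢K q≢L))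
      (subst (ℕ._< toℕ q) (sym toℕ-L) (ℕP.≤∧≢⇒< (subst (ℕ._< toℕ q) toℕ-K p<q) (≢L⇒toℕ≢ q≢L ∘ sym)))
    by-cases (no _) (yes refl) (yes refl) _ = ⊥-elim (ℕP.<-asym K<L p<q)
    by-cases (no _) (yes refl) _ (yes refl) = ⊥-elim (ℕP.<-irrefl refl p<q)
    by-cases (no _) (yes refl) (no q≢K) (no q≢L) = subst₂ Fin._<_ (sym τ-L) (sym (transpose-other q≢K q≢L))
      (ℕP.<-trans K<L p<q)
    by-cases (no p≢K) (no p≢L) (yes refl) _ = subst₂ Fin._<_ (sym (transpose-other p≢K p≢L)) (sym τ-K)
      (ℕP.<-trans p<q K<L)
    by-cases (no p≢K) (no p≢L) (no _) (yes refl) = subst₂ Fin._<_ (sym (transpose-other p≢K p≢L)) (sym τ-L)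
      (subst (toℕ p ℕ.<_) (sym toℕ-K) (ℕP.≤∧≢⇒< (ℕP.≤-pred (subst (toℕ p ℕ.<_) toℕ-L p<q)) (≢K⇒toℕ≢ p≢K)))
    by-cases (no p≢K) (no p≢L) (no q≢K) (no q≢L) = subst₂ Fin._<_ (sym (transpose-other p≢K p≢L)) (sym (transpose-other q≢K q≢L)) p<q

  τ-reflects-< : ∀ {p q} → τ p Fin.< τ q → ¬ (p ≡ L × q ≡ K) → p Fin.< q
  τ-reflects-< {p} {q} τp<τq ¬LK = subst₂ Fin._<_ (τ-involutive p) (τ-involutive q) (τ-preserves-< τp<τq ¬KL)
    where
    ¬KL : ¬ (τ p ≡ K × τ q ≡ L)
    ¬KL (τp≡K , τq≡L) = ¬LK (trans (sym (τ-involutive p)) (trans (cong τ τp≡K) τ-K) ,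
                              trans (sym (τ-involutive q)) (trans (cong τ τq≡L) τ-L))

  isKL : Fin n → Fin n → ℕ
  isKL p q = indicator (⌊ p Fin.≟ K ⌋ ∧ ⌊ q Fin.≟ L ⌋)

  isKL-≢ : ∀ {p q} → ¬ (p ≡ K × q ≡ L) → isKL p q ≡ 0
  isKL-≢ {p} {q} ¬KL with p Fin.≟ K
  ... | no p≢K   = refl
  ... | yes refl = trans (cong (λ b → indicator (true ∧ b)) (⌊⌋-false (q Fin.≟ L) λ q≡L → ¬KL (refl , q≡L))) refl

  sum-isKL : ℕΣ.sum (λ p → ℕΣ.sum (isKL p)) ≡ 1
  sum-isKL = begin
    ℕΣ.sum (λ p → ℕΣ.sum (isKL p)) ≡⟨ ℕΣ.sum-cong-≗ (λ p → ℕΣ.sum-single (isKL p) L λ q q≢L → isKL-≢ λ (_ , q≡L) → q≢L q≡L) ⟩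
    ℕΣ.sum (λ p → isKL p L)        ≡⟨ ℕΣ.sum-single (λ p → isKL p L) K (λ p p≢K → isKL-≢ λ (p≡K , _) → p≢K p≡K) ⟩
    isKL K L                       ≡⟨ cong₂ (λ a b → indicator (a ∧ b)) (⌊⌋-true (K Fin.≟ K) refl) (⌊⌋-true (L Fin.≟ L) refl) ⟩
    1 ∎
    where open ≡-Reasoning

  module _ (w : OneLine n) (ascent : lookup w K Fin.< lookup w L) where

    inversion-rightMulS : ∀ p q → inversion (rightMulS w i h) p q ≡ inversion w (τ p) (τ q) ℕ.+ isKL p q
    inversion-rightMulS p q =
      trans (cong₂ (λ x y → indicator (⌊ p Fin.<? q ⌋ ∧ ⌊ x Fin.<? y ⌋)) (lookup-rightMulS w q) (lookup-rightMulS w p))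
            (by-cases (p Fin.≟ K) (q Fin.≟ L) (p Fin.≟ L) (q Fin.≟ K))
      where
      B : Bool
      B = ⌊ lookup w (τ q) Fin.<? lookup w (τ p) ⌋
      Goal : Set
      Goal = indicator (⌊ p Fin.<? q ⌋ ∧ B) ≡ indicator (⌊ τ p Fin.<? τ q ⌋ ∧ B) ℕ.+ isKL p q
      order-kept : ¬ (p ≡ K × q ≡ L) → ¬ (p ≡ L × q ≡ K) → Goal
      order-kept ¬KL ¬LK = trans
        (cong (λ b → indicator (b ∧ B)) (⌊⌋-⇔ (p Fin.<? q) (τ p Fin.<? τ q)
          (λ p<q → τ-preserves-< p<q ¬KL) (λ τp<τq → τ-reflects-< τp<τq ¬LK)))
        (sym (trans (cong (indicator (⌊ τ p Fin.<? τ q ⌋ ∧ B) ℕ.+_) (isKL-≢ ¬KL)) (ℕP.+-identityʳ _)))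
      by-cases : Dec (p ≡ K) → Dec (q ≡ L) → Dec (p ≡ L) → Dec (q ≡ K) → Goal
      by-cases (yes refl) (yes refl) _ _ = trans
        (cong₂ (λ a b → indicator (a ∧ b)) (⌊⌋-true (p Fin.<? q) K<L)
               (⌊⌋-true (_ Fin.<? _) (subst₂ (λ x y → lookup w x Fin.< lookup w y) (sym τ-L) (sym τ-K) ascent)))
        (sym (cong₂ (λ a k → indicator (a ∧ B) ℕ.+ k)
               (⌊⌋-false (τ p Fin.<? τ q) λ τK<τL → ℕP.<-asym K<L (subst₂ Fin._<_ τ-K τ-L τK<τL))
               (cong₂ (λ a b → indicator (a ∧ b)) (⌊⌋-true (p Fin.≟ K) refl) (⌊⌋-true (q Fin.≟ L) refl))))
      by-cases (yes refl) (no q≢L) _ _ = order-kept (λ (_ , q≡L) → q≢L q≡L) λ (p≡L , _) → K≢L p≡L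
      by-cases (no p≢K) _ (yes refl) (yes refl) = trans
        (cong (λ a → indicator (a ∧ B)) (⌊⌋-false (p Fin.<? q) (ℕP.<-asym K<L)))
        (sym (trans (cong₂ (λ b k → indicator (⌊ τ p Fin.<? τ q ⌋ ∧ b) ℕ.+ k)
                      (⌊⌋-false (_ Fin.<? _) λ wL<wK → ℕP.<-asym ascent (subst₂ (λ x y → lookup w x Fin.< lookup w y) τ-K τ-L wL<wK))
                      (cong (λ a → indicator (a ∧ ⌊ q Fin.≟ L ⌋)) (⌊⌋-false (p Fin.≟ K) p≢K)))
                    (cong (λ b → indicator b ℕ.+ 0) (∧-zeroʳ _))))
      by-cases (no p≢K) _ (yes refl) (no q≢K) = order-kept (λ (p≡K , _) → p≢K p≡K) λ (_ , q≡K) → q≢K q≡K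
      by-cases (no p≢K) _ (no p≢L) _ = order-kept (λ (p≡K , _) → p≢K p≡K) λ (p≡L , _) → p≢L p≡L

    len-rightMulS-ascent : len (rightMulS w i h) ≡ suc (len w)
    len-rightMulS-ascent = begin
      len (rightMulS w i h)
        ≡⟨ len-as-sum (rightMulS w i h) ⟩
      ℕΣ.sum (λ p → ℕΣ.sum (inversion (rightMulS w i h) p))
        ≡⟨ ℕΣ.sum-cong-≗ (λ p → trans (ℕΣ.sum-cong-≗ (inversion-rightMulS p)) (ℕΣ.∑-distrib-+ _ (isKL p))) ⟩
      ℕΣ.sum (λ p → ℕΣ.sum (λ q → inversion w (τ p) (τ q)) ℕ.+ ℕΣ.sum (isKL p))
        ≡⟨ ℕΣ.∑-distrib-+ (λ p → ℕΣ.sum (λ q → inversion w (τ p) (τ q))) _ ⟩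
      ℕΣ.sum (λ p → ℕΣ.sum (λ q → inversion w (τ p) (τ q))) ℕ.+ ℕΣ.sum (λ p → ℕΣ.sum (isKL p))
        ≡⟨ cong₂ ℕ._+_ (trans (ℕΣ.sum-cong-≗ λ p → ℕΣ.sum-transpose (inversion w (τ p)) K L)
                              (ℕΣ.sum-transpose (λ p → ℕΣ.sum (inversion w p)) K L))
                       sum-isKL ⟩
      ℕΣ.sum (λ p → ℕΣ.sum (inversion w p)) ℕ.+ 1
        ≡⟨ cong (ℕ._+ 1) (len-as-sum w) ⟨
      len w ℕ.+ 1
        ≡⟨ ℕP.+-comm (len w) 1 ⟩
      suc (len w) ∎
      where open ≡-Reasoning

  IsPerm-rightMulS : ∀ w → IsPerm w → IsPerm (rightMulS w i h)
  IsPerm-rightMulS w perm k = τ (proj₁ (perm k)) ,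
    trans (lookup-rightMulS w _) (trans (cong (lookup w) (τ-involutive _)) (proj₂ (perm k)))

  injective-rightMulS : ∀ v → Injective _≡_ _≡_ (lookup v) → Injective _≡_ _≡_ (lookup (rightMulS v i h))
  injective-rightMulS v v-inj {j} {j'} e =
    trans (sym (τ-involutive j)) (trans (cong τ (v-inj (trans (sym (lookup-rightMulS v j)) (trans e (lookup-rightMulS v j'))))) (τ-involutive j'))

  rightMulS-fixed : ∀ w → lookup w K ≡ lookup w L → rightMulS w i h ≡ w
  rightMulS-fixed w wK≡wL = Pointwise-≡⇒≡ (ext λ j → trans (lookup-rightMulS w j) (by-cases j (j Fin.≟ K) (j Fin.≟ L)))
    where
    by-cases : ∀ j → Dec (j ≡ K) → Dec (j ≡ L) → lookup w (τ j) ≡ lookup w j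
    by-cases j (yes refl) _          = trans (cong (lookup w) τ-K) (sym wK≡wL)
    by-cases j (no _)     (yes refl) = trans (cong (lookup w) τ-L) wK≡wL
    by-cases j (no j≢K)   (no j≢L)   = cong (lookup w) (transpose-other j≢K j≢L)

  length-descent : ∀ u → len (rightMulS u i h) < len u → lookup u L Fin.< lookup u K
  length-descent u shorter with ℕP.<-cmp (toℕ (lookup u K)) (toℕ (lookup u L))
  ... | tri< ascent _ _ = ⊥-elim (ℕP.<-asym shorter (subst (len u <_) (sym (len-rightMulS-ascent u ascent)) (ℕP.n<1+n _)))
  ... | tri≈ _ same _   = ⊥-elim (ℕP.<-irrefl (cong len (rightMulS-fixed u (FP.toℕ-injective same))) shorter)
  ... | tri> _ _ descent = descent

  entry-i : ∀ w → entry w i ≡ toℕ (lookup w K)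
  entry-i w = trans (cong (entry w) (sym toℕ-K)) (entry-toℕ w K)

  entry-suc-i : ∀ w → entry w (suc i) ≡ toℕ (lookup w L)
  entry-suc-i w = trans (cong (entry w) (sym toℕ-L)) (entry-toℕ w L)

  module _ (w : OneLine n) where

    private
      ws : OneLine n
      ws = rightMulS w i h

    entry-rightMulS-i : entry ws i ≡ entry w (suc i)
    entry-rightMulS-i = trans (entry-i ws) (trans (cong toℕ (rightMulS-K w)) (sym (entry-suc-i w)))

    entry-rightMulS-suc-i : entry ws (suc i) ≡ entry w i
    entry-rightMulS-suc-i = trans (entry-suc-i ws) (trans (cong toℕ (rightMulS-L w)) (sym (entry-i w)))

    entry-rightMulS-≢ : ∀ P → P ≢ i → P ≢ suc i → entry ws P ≡ entry w P
    entry-rightMulS-≢ P P≢i P≢1+i with P ℕ.<? n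
    ... | no _    = refl
    ... | yes P<n = cong toℕ (trans (lookup-rightMulS w p) (cong (lookup w) (transpose-other p≢K p≢L)))
      where
      p : Fin n
      p = fromℕ< P<n
      p≢K : p ≢ K
      p≢K p≡K = P≢i (trans (sym (FP.toℕ-fromℕ< P<n)) (trans (cong toℕ p≡K) toℕ-K))
      p≢L : p ≢ L
      p≢L p≡L = P≢1+i (trans (sym (FP.toℕ-fromℕ< P<n)) (trans (cong toℕ p≡L) toℕ-L))

    rank-rightMulS-≤ : ∀ P Q → P ≤ i → rank ws P Q ≡ rank w P Q
    rank-rightMulS-≤ zero    Q _   = refl
    rank-rightMulS-≤ (suc P) Q P<i = cong₂ ℕ._+_ (rank-rightMulS-≤ P Q (ℕP.<⇒≤ P<i))
      (cong (atLeast Q) (entry-rightMulS-≢ P (ℕP.<⇒≢ P<i) (ℕP.<⇒≢ (ℕP.m<n⇒m<1+n P<i))))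

    rank-rightMulS-suc-i : ∀ Q → rank ws (suc i) Q ≡ rank w i Q ℕ.+ atLeast Q (entry w (suc i))
    rank-rightMulS-suc-i Q = cong₂ ℕ._+_ (rank-rightMulS-≤ i Q ℕP.≤-refl) (cong (atLeast Q) entry-rightMulS-i)

    rank-rightMulS-≥ : ∀ P Q → suc (suc i) ≤ P → rank ws P Q ≡ rank w P Q
    rank-rightMulS-≥ (suc P) Q (s≤s i<P) with P ℕ.≟ suc i
    ... | yes refl = begin
      rank ws (suc i) Q ℕ.+ atLeast Q (entry ws (suc i))
        ≡⟨ cong₂ ℕ._+_ (rank-rightMulS-suc-i Q) (cong (atLeast Q) entry-rightMulS-suc-i) ⟩
      rank w i Q ℕ.+ atLeast Q (entry w (suc i)) ℕ.+ atLeast Q (entry w i)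
        ≡⟨ ℕP.+-assoc (rank w i Q) _ _ ⟩
      rank w i Q ℕ.+ (atLeast Q (entry w (suc i)) ℕ.+ atLeast Q (entry w i))
        ≡⟨ cong (rank w i Q ℕ.+_) (ℕP.+-comm (atLeast Q (entry w (suc i))) _) ⟩
      rank w i Q ℕ.+ (atLeast Q (entry w i) ℕ.+ atLeast Q (entry w (suc i)))
        ≡⟨ ℕP.+-assoc (rank w i Q) _ _ ⟨
      rank w (suc (suc i)) Q ∎
      where open ≡-Reasoning
    ... | no P≢1+i = cong₂ ℕ._+_ (rank-rightMulS-≥ P Q (ℕP.≤∧≢⇒< i<P (P≢1+i ∘ sym)))
      (cong (atLeast Q) (entry-rightMulS-≢ P (ℕP.<⇒≢ i<P ∘ sym) P≢1+i))

    rank-rightMulS-≢ : ∀ P Q → P ≢ suc i → rank ws P Q ≡ rank w P Q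
    rank-rightMulS-≢ P Q P≢1+i with P ℕ.≤? i
    ... | yes P≤i = rank-rightMulS-≤ P Q P≤i
    ... | no P≰i  = rank-rightMulS-≥ P Q (ℕP.≤∧≢⇒< (ℕP.≰⇒> P≰i) (P≢1+i ∘ sym))

  rank-≤-rightMulS : ∀ w → entry w i ≤ entry w (suc i) → ∀ P Q → rank w P Q ≤ rank (rightMulS w i h) P Q
  rank-≤-rightMulS w ascent P Q with P ℕ.≟ suc i
  ... | yes refl = ℕP.≤-trans (ℕP.+-monoʳ-≤ (rank w i Q) (atLeast-mono Q ascent)) (ℕP.≤-reflexive (sym (rank-rightMulS-suc-i w Q)))
  ... | no P≢1+i = ℕP.≤-reflexive (sym (rank-rightMulS-≢ w P Q P≢1+i))

  NotBelow-rightMulSˡ : ∀ w v → entry w i ≤ entry w (suc i) → NotBelow w v → NotBelow (rightMulS w i h) v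
  NotBelow-rightMulSˡ w v ascent (P , Q , v<w) = P , Q , ℕP.<-≤-trans v<w (rank-≤-rightMulS w ascent P Q)

  NotBelow-descent : ∀ u → entry u (suc i) < entry u i → NotBelow u (rightMulS u i h)
  NotBelow-descent u descent = suc i , entry u i , subst₂ _<_ (sym us-rank) (sym u-rank) (ℕP.n<1+n _)
    where
    us-rank : rank (rightMulS u i h) (suc i) (entry u i) ≡ rank u i (entry u i)
    us-rank = trans (rank-rightMulS-suc-i u _) (trans (cong (rank u i (entry u i) ℕ.+_) (atLeast-≰ _ _ (ℕP.<⇒≱ descent))) (ℕP.+-identityʳ _))
    u-rank : rank u (suc i) (entry u i) ≡ suc (rank u i (entry u i))
    u-rank = trans (cong (rank u i (entry u i) ℕ.+_) (atLeast-≤ _ _ ℕP.≤-refl)) (ℕP.+-comm _ 1)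

  lift-separation : ∀ w v Q → entry w i < entry w (suc i) →
    rank v i Q ≡ rank w i Q → Q ≤ entry w i → ¬ Q ≤ entry v i → NotBelow (rightMulS w i h) (rightMulS v i h)
  lift-separation w v Q ascent same Q≤wᵢ Q≰vᵢ = by-cases (Q ℕ.≤? entry v (suc i))
    where
    a : ℕ
    a = rank w i Q
    Q≤wᵢ₊₁ : Q ≤ entry w (suc i)
    Q≤wᵢ₊₁ = ℕP.≤-trans Q≤wᵢ (ℕP.<⇒≤ ascent)
    ws-rank : rank (rightMulS w i h) (suc i) Q ≡ suc a
    ws-rank = trans (rank-rightMulS-suc-i w Q) (trans (cong (a ℕ.+_) (atLeast-≤ Q _ Q≤wᵢ₊₁)) (ℕP.+-comm a 1))
    by-cases : Dec (Q ≤ entry v (suc i)) → NotBelow (rightMulS w i h) (rightMulS v i h)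
    by-cases (no Q≰vᵢ₊₁)  = suc i , Q , subst₂ _<_ (sym vs-rank) (sym ws-rank) (ℕP.n<1+n a)
      where
      vs-rank : rank (rightMulS v i h) (suc i) Q ≡ a
      vs-rank = trans (rank-rightMulS-suc-i v Q) (trans (cong₂ ℕ._+_ same (atLeast-≰ Q _ Q≰vᵢ₊₁)) (ℕP.+-identityʳ a))
    by-cases (yes Q≤vᵢ₊₁) = suc (suc i) , Q , subst₂ _<_ (sym vs-rank) (sym ws-rank₂) (ℕP.n<1+n (suc a))
      where
      open ≡-Reasoning
      vs-rank : rank (rightMulS v i h) (suc (suc i)) Q ≡ suc a
      vs-rank = begin
        rank (rightMulS v i h) (suc (suc i)) Q                                ≡⟨ rank-rightMulS-≥ v (suc (suc i)) Q ℕP.≤-refl ⟩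
        rank v i Q ℕ.+ atLeast Q (entry v i) ℕ.+ atLeast Q (entry v (suc i))
          ≡⟨ cong₂ (λ r k → r ℕ.+ k ℕ.+ atLeast Q (entry v (suc i))) same (atLeast-≰ Q _ Q≰vᵢ) ⟩
        a ℕ.+ 0 ℕ.+ atLeast Q (entry v (suc i))                               ≡⟨ cong (a ℕ.+ 0 ℕ.+_) (atLeast-≤ Q _ Q≤vᵢ₊₁) ⟩
        a ℕ.+ 0 ℕ.+ 1                                                         ≡⟨ cong (ℕ._+ 1) (ℕP.+-identityʳ a) ⟩
        a ℕ.+ 1                                                               ≡⟨ ℕP.+-comm a 1 ⟩
        suc a ∎
      ws-rank₂ : rank (rightMulS w i h) (suc (suc i)) Q ≡ suc (suc a)
      ws-rank₂ = begin
        rank (rightMulS w i h) (suc (suc i)) Q                                ≡⟨ rank-rightMulS-≥ w (suc (suc i)) Q ℕP.≤-refl ⟩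
        a ℕ.+ atLeast Q (entry w i) ℕ.+ atLeast Q (entry w (suc i))
          ≡⟨ cong₂ (λ k l → a ℕ.+ k ℕ.+ l) (atLeast-≤ Q _ Q≤wᵢ) (atLeast-≤ Q _ Q≤wᵢ₊₁) ⟩
        a ℕ.+ 1 ℕ.+ 1                                                         ≡⟨ ℕP.+-comm (a ℕ.+ 1) 1 ⟩
        suc (a ℕ.+ 1)                                                         ≡⟨ cong suc (ℕP.+-comm a 1) ⟩
        suc (suc a) ∎

  NotBelow-rightMulS : ∀ w v → entry w i < entry w (suc i) → NotBelow w v → NotBelow (rightMulS w i h) (rightMulS v i h)
  NotBelow-rightMulS w v ascent (P , Q , v<w) with P ℕ.≟ suc i
  ... | no P≢1+i = P , Q , subst₂ _<_ (sym (rank-rightMulS-≢ v P Q P≢1+i)) (sym (rank-rightMulS-≢ w P Q P≢1+i)) v<w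
  ... | yes refl with rank v i Q ℕ.<? rank w i Q
  ...   | yes v<wᵢ = i , Q , subst₂ _<_ (sym (rank-rightMulS-≤ v i Q ℕP.≤-refl)) (sym (rank-rightMulS-≤ w i Q ℕP.≤-refl)) v<wᵢ
  ...   | no v≮wᵢ with rank-separates w v i Q v<w (ℕP.≮⇒≥ v≮wᵢ)
  ...     | same , Q≤wᵢ , Q≰vᵢ = lift-separation w v Q ascent same Q≤wᵢ Q≰vᵢ

  specialize-divided-difference : ∀ (v : OneLine n) P Q →
    (xpow K (+ 1) ⊖ xpow L (+ 1)) ⊗ P ≈ xpow K (+ 1) ⊗ Q ⊖ xpow L (+ 1) ⊗ swapX K L Q →
    (ypow (lookup v K) (+ 1) ⊖ ypow (lookup v L) (+ 1)) ⊗ specialize v P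
      ≈ ypow (lookup v K) (+ 1) ⊗ specialize v Q ⊖ ypow (lookup v L) (+ 1) ⊗ specialize (rightMulS v i h) Q
  specialize-divided-difference v P Q relation =
    subst₂ _≈_ lhs rhs (specialize-cong v ((xpow K (+ 1) ⊖ xpow L (+ 1)) ⊗ P) (xpow K (+ 1) ⊗ Q ⊖ xpow L (+ 1) ⊗ swapX K L Q) relation)
    where
    open ≡-Reasoning
    lhs : specialize v ((xpow K (+ 1) ⊖ xpow L (+ 1)) ⊗ P) ≡ (ypow (lookup v K) (+ 1) ⊖ ypow (lookup v L) (+ 1)) ⊗ specialize v P
    lhs = begin
      specialize v ((xpow K (+ 1) ⊖ xpow L (+ 1)) ⊗ P)
        ≡⟨ specialize-⊗ v (xpow K (+ 1) ⊖ xpow L (+ 1)) P ⟩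
      specialize v (xpow K (+ 1) ⊖ xpow L (+ 1)) ⊗ specialize v P
        ≡⟨ cong (_⊗ specialize v P) (specialize-⊖ v (xpow K (+ 1)) (xpow L (+ 1))) ⟩
      (specialize v (xpow K (+ 1)) ⊖ specialize v (xpow L (+ 1))) ⊗ specialize v P
        ≡⟨ cong₂ (λ a b → (a ⊖ b) ⊗ specialize v P) (specialize-xpow v K (+ 1)) (specialize-xpow v L (+ 1)) ⟩
      (ypow (lookup v K) (+ 1) ⊖ ypow (lookup v L) (+ 1)) ⊗ specialize v P ∎
    rhs : specialize v (xpow K (+ 1) ⊗ Q ⊖ xpow L (+ 1) ⊗ swapX K L Q)
          ≡ ypow (lookup v K) (+ 1) ⊗ specialize v Q ⊖ ypow (lookup v L) (+ 1) ⊗ specialize (rightMulS v i h) Q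
    rhs = begin
      specialize v (xpow K (+ 1) ⊗ Q ⊖ xpow L (+ 1) ⊗ swapX K L Q)
        ≡⟨ specialize-⊖ v (xpow K (+ 1) ⊗ Q) (xpow L (+ 1) ⊗ swapX K L Q) ⟩
      specialize v (xpow K (+ 1) ⊗ Q) ⊖ specialize v (xpow L (+ 1) ⊗ swapX K L Q)
        ≡⟨ cong₂ _⊖_ (specialize-⊗ v (xpow K (+ 1)) Q) (specialize-⊗ v (xpow L (+ 1)) (swapX K L Q)) ⟩
      specialize v (xpow K (+ 1)) ⊗ specialize v Q ⊖ specialize v (xpow L (+ 1)) ⊗ specialize v (swapX K L Q)
        ≡⟨ cong₂ (λ a b → a ⊗ specialize v Q ⊖ b) (specialize-xpow v K (+ 1))
                 (cong₂ _⊗_ (specialize-xpow v L (+ 1)) (specialize-swapX v K L Q)) ⟩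
      ypow (lookup v K) (+ 1) ⊗ specialize v Q ⊖ ypow (lookup v L) (+ 1) ⊗ specialize (rightMulS v i h) Q ∎

module _ {n : ℕ} where

  module Decreasing (w : OneLine n) (decreasing : ∀ P → suc P < n → entry w (suc P) < entry w P) where

    entry+index<n : ∀ P → P < n → entry w P ℕ.+ P < n
    entry+index<n zero    P<n with zero ℕ.<? n
    ... | yes 0<n = subst (_< n) (sym (ℕP.+-identityʳ _)) (FP.toℕ<n _)
    ... | no 0≮n  = ⊥-elim (0≮n P<n)
    entry+index<n (suc P) P<n = begin-strict
      entry w (suc P) ℕ.+ suc P   ≡⟨ ℕP.+-suc _ P ⟩
      suc (entry w (suc P)) ℕ.+ P ≤⟨ ℕP.+-monoˡ-≤ P (decreasing P P<n) ⟩
      entry w P ℕ.+ P             <⟨ entry+index<n P (ℕP.<-trans (ℕP.n<1+n P) P<n) ⟩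
      n ∎
      where open ℕP.≤-Reasoning

    n≤entry+index : ∀ d P → d ℕ.+ suc P ≡ n → n ≤ entry w P ℕ.+ suc P
    n≤entry+index zero     P refl = ℕP.m≤n+m (suc P) (entry w P)
    n≤entry+index (suc d)  P eq   = begin
      n                                 ≤⟨ n≤entry+index d (suc P) (trans (ℕP.+-suc d (suc P)) eq) ⟩
      entry w (suc P) ℕ.+ suc (suc P)   ≡⟨ ℕP.+-suc _ (suc P) ⟩
      suc (entry w (suc P)) ℕ.+ suc P   ≤⟨ ℕP.+-monoˡ-≤ (suc P) (decreasing P 1+P<n) ⟩
      entry w P ℕ.+ suc P ∎
      where
      open ℕP.≤-Reasoning
      1+P<n : suc P < n
      1+P<n = subst (suc P <_) eq (s≤s (ℕP.m≤n+m (suc P) d))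

    decreasing⇒opposite : ∀ k → lookup w k ≡ opposite k
    decreasing⇒opposite k = FP.toℕ-injective (begin
      toℕ (lookup w k)              ≡⟨ entry-toℕ w k ⟨
      entry w P                     ≡⟨ ℕP.m+n∸n≡m (entry w P) (suc P) ⟨
      entry w P ℕ.+ suc P ∸ suc P   ≡⟨ cong (_∸ suc P) entry+suc-index≡n ⟩
      n ∸ suc P                     ≡⟨ FP.opposite-prop k ⟨
      toℕ (opposite k) ∎)
      where
      open ≡-Reasoning
      P : ℕ
      P = toℕ k
      entry+suc-index≡n : entry w P ℕ.+ suc P ≡ n
      entry+suc-index≡n = ℕP.≤-antisym (subst (_≤ n) (sym (ℕP.+-suc _ P)) (entry+index<n P (FP.toℕ<n k)))
                                        (n≤entry+index (n ∸ suc P) P (ℕP.m∸n+n≡m (FP.toℕ<n k)))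

  -- w₀ is below every v unless v(p) < w₀(p) for some p, i.e. some factor 1 - y_{v(p)}/x_p of G_{w₀} vanishes at y_v.
  NotBelow-opposite : ∀ w v → (∀ k → lookup w k ≡ opposite k) → NotBelow w v →
    ∃[ p ] suc (suc (toℕ p ℕ.+ toℕ (lookup v p))) ≤ n
  NotBelow-opposite w v w≡w₀ (P , Q , v<w) with FP.any? (λ p → suc (suc (toℕ p ℕ.+ toℕ (lookup v p))) ℕ.≤? n)
  ... | yes small = small
  ... | no none   = ⊥-elim (ℕP.<⇒≱ v<w (rank-mono w v w≤v P Q))
    where
    w≤v : ∀ m → entry w m ≤ entry v m
    w≤v m with m ℕ.<? n
    ... | no m≮n  = ℕP.≤-reflexive (trans (entry-≮n w m≮n) (sym (entry-≮n v m≮n)))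
    ... | yes m<n = begin
      entry w m                 ≡⟨ entry-<n w m<n ⟩
      toℕ (lookup w p)          ≡⟨ cong toℕ (w≡w₀ p) ⟩
      toℕ (opposite p)          ≡⟨ FP.opposite-prop p ⟩
      n ∸ suc (toℕ p)           ≤⟨ ℕP.m≤n+o⇒m∸n≤o n (suc (toℕ p)) (ℕP.≤-pred (ℕP.≰⇒> λ small → none (p , small))) ⟩
      toℕ (lookup v p)          ≡⟨ entry-<n v m<n ⟨
      entry v m ∎
      where
      open ℕP.≤-Reasoning
      p : Fin n
      p = fromℕ< m<n

module _ {n : ℕ} where

  unitᵥ-+ᵥ-neg : ∀ (k : Fin n) → unitᵥ k (+ 1) +ᵥ unitᵥ k -[1+ 0 ] ≡ zeroV
  unitᵥ-+ᵥ-neg k = pointwise λ j → trans (lookup-+ᵥ (unitᵥ k (+ 1)) (unitᵥ k -[1+ 0 ]) j) (by-cases j (j Fin.≟ k))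
    where
    by-cases : ∀ j → Dec (j ≡ k) → lookup (unitᵥ k (+ 1)) j + lookup (unitᵥ k -[1+ 0 ]) j ≡ lookup zeroV j
    by-cases j (yes refl) = trans (cong₂ _+_ (VP.lookup∘update j zeroV (+ 1)) (VP.lookup∘update j zeroV -[1+ 0 ])) (sym (lookup-zeroV j))
    by-cases j (no j≢k)   = trans (cong₂ _+_ (lookup-unitᵥ-≢ (+ 1) j≢k) (lookup-unitᵥ-≢ -[1+ 0 ] j≢k)) (sym (lookup-zeroV j))

  specialize-factor-vanishes : ∀ (v : OneLine n) p → IsZero (specialize v (one ⊖ ypow (lookup v p) (+ 1) ⊗ xpow p -[1+ 0 ]))
  specialize-factor-vanishes v p = subst IsZero (sym specialized) (≈⇒IsZero-⊖ one one λ _ _ → refl)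
    where
    q : Fin n
    q = lookup v p
    specialized : specialize v (one ⊖ ypow q (+ 1) ⊗ xpow p -[1+ 0 ]) ≡ one ⊖ one
    specialized = begin
      specialize v (one ⊖ ypow q (+ 1) ⊗ xpow p -[1+ 0 ])
        ≡⟨ specialize-⊖ v one (ypow q (+ 1) ⊗ xpow p -[1+ 0 ]) ⟩
      specialize v one ⊖ specialize v (ypow q (+ 1) ⊗ xpow p -[1+ 0 ])
        ≡⟨ cong₂ _⊖_ (specialize-one v) (specialize-⊗ v (ypow q (+ 1)) (xpow p -[1+ 0 ])) ⟩
      one ⊖ specialize v (ypow q (+ 1)) ⊗ specialize v (xpow p -[1+ 0 ])
        ≡⟨ cong (λ r → one ⊖ r) (cong₂ _⊗_ (specialize-ypow v q (+ 1)) (specialize-xpow v p -[1+ 0 ])) ⟩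
      one ⊖ ypow q (+ 1) ⊗ ypow q -[1+ 0 ]
        ≡⟨ cong₂ (λ a b → one ⊖ mono (+ 1) a b) (+ᵥ-identityˡ zeroV) (unitᵥ-+ᵥ-neg q) ⟩
      one ⊖ one ∎
      where open ≡-Reasoning

  factorsOfTopG : Fin n × Fin n → List (Laurent n)
  factorsOfTopG (p , q) =
    if ⌊ suc (suc (toℕ p ℕ.+ toℕ q)) ℕ.≤? n ⌋ then (one ⊖ ypow q (+ 1) ⊗ xpow p -[1+ 0 ]) ∷ [] else []

  specialize-topG-vanishes : ∀ (v : OneLine n) p → suc (suc (toℕ p ℕ.+ toℕ (lookup v p))) ≤ n → IsZero (specialize v (topG n))
  specialize-topG-vanishes v p small = subst IsZero (sym (specialize-prodL v (concatMap factorsOfTopG (pairs n))))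
    (IsZero-prodL (AnyP.map⁺ (AnyP.concatMap⁺ factorsOfTopG inPairs)))
    where
    factor : Any (IsZero ∘ specialize v) (factorsOfTopG (p , lookup v p))
    factor = subst (λ b → Any (IsZero ∘ specialize v) (if b then (one ⊖ ypow (lookup v p) (+ 1) ⊗ xpow p -[1+ 0 ]) ∷ [] else []))
                   (sym (⌊⌋-true (suc (suc (toℕ p ℕ.+ toℕ (lookup v p))) ℕ.≤? n) small)) (here (specialize-factor-vanishes v p))
    inPairs : Any (Any (IsZero ∘ specialize v) ∘ factorsOfTopG) (pairs n)
    inPairs = AnyP.concatMap⁺ (λ p → List.map (p ,_) (allFin n)) (AnyP.tabulate⁺ p (AnyP.map⁺ (AnyP.tabulate⁺ (lookup v p) factor)))

-- Vanishing of G_w(y_v)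

module Vanishing {n : ℕ} (G : OneLine n → Laurent n) (isG : IsDoubleGrothendieck n G) where
  open IsDoubleGrothendieck isG

  Ascent : OneLine n → ℕ → Set
  Ascent w P = suc P < n × entry w P < entry w (suc P)

  no-ascent⇒decreasing : ∀ w → IsPerm w → ¬ (∃[ j ] Ascent w (toℕ j)) → ∀ P → suc P < n → entry w (suc P) < entry w P
  no-ascent⇒decreasing w perm none P h =
    ℕP.≤∧≢⇒< (ℕP.≮⇒≥ λ ascent → none (K , subst (Ascent w) (sym toℕ-K) (h , ascent))) entries-differ
    where
    open AdjacentTransposition P h using (K; K≢L; toℕ-K; entry-i; entry-suc-i)
    entries-differ : entry w (suc P) ≢ entry w P
    entries-differ e = K≢L (IsPerm⇒injective w perm (FP.toℕ-injective (trans (sym (entry-i w)) (trans (sym e) (entry-suc-i w)))))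

  -- Downward induction on ℓ(w), with fuel d bounding the distance to the maximal length.
  vanishes′ : ∀ d w → length (pairs n) ≤ len w ℕ.+ d → IsPerm w →
    ∀ v → Injective _≡_ _≡_ (lookup v) → NotBelow w v → IsZero (specialize v (G w))
  vanishes′ d w bound perm v v-inj w≰v with FP.any? (λ j → (suc (toℕ j) ℕ.<? n) ×-dec (entry w (toℕ j) ℕ.<? entry w (suc (toℕ j))))
  ... | no none = IsZero-resp-≈ (specialize v (G w)) (specialize v (topG n)) G-w≈top (specialize-topG-vanishes v p small)
    where
    w≡w₀ : ∀ k → lookup w k ≡ opposite k
    w≡w₀ = Decreasing.decreasing⇒opposite w (no-ascent⇒decreasing w perm none)
    G-w≈top : specialize v (G w) ≈ specialize v (topG n)
    G-w≈top = specialize-cong v (G w) (topG n) (top w w≡w₀)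
    p : Fin n
    p = proj₁ (NotBelow-opposite w v w≡w₀ w≰v)
    small : suc (suc (toℕ p ℕ.+ toℕ (lookup v p))) ≤ n
    small = proj₂ (NotBelow-opposite w v w≡w₀ w≰v)
  ... | yes (j , h , ascent) = descend d bound
    where
    i : ℕ
    i = toℕ j
    open AdjacentTransposition i h
    ws : OneLine n
    ws = rightMulS w i h
    longer : len ws ≡ suc (len w)
    longer = len-rightMulS-ascent w (subst₂ ℕ._<_ (entry-i w) (entry-suc-i w) ascent)
    descend : ∀ d → length (pairs n) ≤ len w ℕ.+ d → IsZero (specialize v (G w))
    descend zero    bound = ⊥-elim (ℕP.<-irrefl refl (begin-strict
      length (pairs n) ≤⟨ bound ⟩
      len w ℕ.+ 0      ≡⟨ ℕP.+-identityʳ (len w) ⟩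
      len w            <⟨ ℕP.n<1+n (len w) ⟩
      suc (len w)      ≡⟨ longer ⟨
      len ws           ≤⟨ len≤length-pairs ws ⟩
      length (pairs n) ∎))
      where open ℕP.≤-Reasoning
    descend (suc d) bound = IsZero-cancel-ydiff (K≢L ∘ v-inj) (specialize v (G w)) (IsZero-resp-≈ lhs rhs relation rhs-vanishes)
      where
      bound′ : length (pairs n) ≤ len ws ℕ.+ d
      bound′ = subst (length (pairs n) ≤_) (trans (ℕP.+-suc (len w) d) (cong (ℕ._+ d) (sym longer))) bound
      below : ∀ v → Injective _≡_ _≡_ (lookup v) → NotBelow ws v → IsZero (specialize v (G ws))
      below = vanishes′ d ws bound′ (IsPerm-rightMulS w perm)
      yᵥK yᵥL lhs rhs : Laurent n
      yᵥK = ypow (lookup v K) (+ 1)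
      yᵥL = ypow (lookup v L) (+ 1)
      lhs = (yᵥK ⊖ yᵥL) ⊗ specialize v (G w)
      rhs = yᵥK ⊗ specialize v (G ws) ⊖ yᵥL ⊗ specialize (rightMulS v i h) (G ws)
      relation : lhs ≈ rhs
      relation = specialize-divided-difference v (G w) (G ws) (step w perm i h longer)
      rhs-vanishes : IsZero rhs
      rhs-vanishes = IsZero-⊖ (yᵥK ⊗ specialize v (G ws)) (yᵥL ⊗ specialize (rightMulS v i h) (G ws))
        (IsZero-⊗ʳ yᵥK (specialize v (G ws)) (below v v-inj (NotBelow-rightMulSˡ w v (ℕP.<⇒≤ ascent) w≰v)))
        (IsZero-⊗ʳ yᵥL (specialize (rightMulS v i h) (G ws)) (below (rightMulS v i h) (injective-rightMulS v v-inj) (NotBelow-rightMulS w v ascent w≰v)))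

  vanishes : ∀ w → IsPerm w → ∀ v → Injective _≡_ _≡_ (lookup v) → NotBelow w v → IsZero (specialize v (G w))
  vanishes w = vanishes′ (length (pairs n)) w (ℕP.m≤n+m _ _)

module _ {n : ℕ} where

  coeff-ypow-⊗ : ∀ (k : Fin n) e P x y → coeff (ypow k e ⊗ P) x y ≡ coeff P x (y −ᵥ unitᵥ k e)
  coeff-ypow-⊗ k e P x y = begin
    coeff (ypow k e ⊗ P) x y                           ≡⟨ coeff-mono-⊗ (+ 1) zeroV (unitᵥ k e) P x y ⟩
    + 1 * coeff P (x −ᵥ zeroV) (y −ᵥ unitᵥ k e)        ≡⟨ ℤP.*-identityˡ _ ⟩
    coeff P (x −ᵥ zeroV) (y −ᵥ unitᵥ k e)              ≡⟨ cong (λ x' → coeff P x' (y −ᵥ unitᵥ k e)) (−ᵥ-identityʳ x) ⟩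
    coeff P x (y −ᵥ unitᵥ k e) ∎
    where open ≡-Reasoning

  coeff-ratio-⊗ : ∀ (a b : Fin n) P x y →
    coeff ((one ⊖ ypow b (+ 1) ⊗ ypow a -[1+ 0 ]) ⊗ P) x y ≡ coeff P x y - coeff P x ((y +ᵥ unitᵥ a (+ 1)) −ᵥ unitᵥ b (+ 1))
  coeff-ratio-⊗ a b P x y = begin
    coeff ((one ⊖ ypow b (+ 1) ⊗ ypow a -[1+ 0 ]) ⊗ P) x y
      ≡⟨ coeff-∷-⊗ (+ 1) zeroV zeroV (mono -[1+ 0 ] (zeroV +ᵥ zeroV) E) P x y ⟩
    + 1 * coeff P (x −ᵥ zeroV) (y −ᵥ zeroV) + coeff (mono -[1+ 0 ] (zeroV +ᵥ zeroV) E ⊗ P) x y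
      ≡⟨ cong₂ (λ u v → + 1 * u + v) (cong₂ (coeff P) (−ᵥ-identityʳ x) (−ᵥ-identityʳ y)) (coeff-mono-⊗ -[1+ 0 ] (zeroV +ᵥ zeroV) E P x y) ⟩
    + 1 * coeff P x y + -[1+ 0 ] * coeff P (x −ᵥ (zeroV +ᵥ zeroV)) (y −ᵥ E)
      ≡⟨ cong₂ (λ x' y' → + 1 * coeff P x y + -[1+ 0 ] * coeff P x' y') (trans (cong (x −ᵥ_) (+ᵥ-identityˡ zeroV)) (−ᵥ-identityʳ x)) shifted ⟩
    + 1 * coeff P x y + -[1+ 0 ] * coeff P x ((y +ᵥ eₐ) −ᵥ e_b)
      ≡⟨ normalise (coeff P x y) _ ⟩
    coeff P x y - coeff P x ((y +ᵥ eₐ) −ᵥ e_b) ∎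
    where
    open ≡-Reasoning
    eₐ e_b E : Vec ℤ n
    eₐ = unitᵥ a (+ 1)
    e_b = unitᵥ b (+ 1)
    E = e_b +ᵥ unitᵥ a -[1+ 0 ]
    normalise : ∀ u v → + 1 * u + -[1+ 0 ] * v ≡ u - v
    normalise = solve-∀
    unit-neg : ∀ j → lookup (unitᵥ a -[1+ 0 ]) j ≡ - lookup eₐ j
    unit-neg j with j Fin.≟ a
    ... | yes refl = trans (VP.lookup∘update j zeroV -[1+ 0 ]) (cong -_ (sym (VP.lookup∘update j zeroV (+ 1))))
    ... | no j≢a   = trans (lookup-unitᵥ-≢ -[1+ 0 ] j≢a) (cong -_ (sym (lookup-unitᵥ-≢ (+ 1) j≢a)))
    shifted : y −ᵥ E ≡ (y +ᵥ eₐ) −ᵥ e_b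
    shifted = pointwise λ j → begin
      lookup (y −ᵥ E) j                                       ≡⟨ lookup-−ᵥ y E j ⟩
      lookup y j - lookup E j                                 ≡⟨ cong (_-_ (lookup y j)) (lookup-+ᵥ e_b (unitᵥ a -[1+ 0 ]) j) ⟩
      lookup y j - (lookup e_b j + lookup (unitᵥ a -[1+ 0 ]) j) ≡⟨ cong (λ z → lookup y j - (lookup e_b j + z)) (unit-neg j) ⟩
      lookup y j - (lookup e_b j + - lookup eₐ j)             ≡⟨ rearrange (lookup y j) (lookup e_b j) (lookup eₐ j) ⟩
      lookup y j + lookup eₐ j - lookup e_b j                 ≡⟨ cong (_- lookup e_b j) (lookup-+ᵥ y eₐ j) ⟨
      lookup (y +ᵥ eₐ) j - lookup e_b j                       ≡⟨ lookup-−ᵥ (y +ᵥ eₐ) e_b j ⟨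
      lookup ((y +ᵥ eₐ) −ᵥ e_b) j ∎
      where
      rearrange : ∀ u v w → u - (v + - w) ≡ u + w - v
      rearrange = solve-∀

  solve-ydiff : ∀ (a b : Fin n) P S Z →
    (ypow b (+ 1) ⊖ ypow a (+ 1)) ⊗ P ≈ ypow b (+ 1) ⊗ Z ⊖ ypow a (+ 1) ⊗ S → IsZero Z →
    S ≈ (one ⊖ ypow b (+ 1) ⊗ ypow a -[1+ 0 ]) ⊗ P
  solve-ydiff a b P S Z relation Z-vanishes x y = begin
    coeff S x y                                 ≡⟨ neg-involutive (coeff S x y) ⟨
    - (+ 0 - coeff S x y)                       ≡⟨ cong -_ relation-at ⟨
    - (coeff P x y′ - coeff P x y)              ≡⟨ neg-minus (coeff P x y′) (coeff P x y) ⟩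
    coeff P x y - coeff P x y′                  ≡⟨ coeff-ratio-⊗ a b P x y ⟨
    coeff ((one ⊖ ypow b (+ 1) ⊗ ypow a -[1+ 0 ]) ⊗ P) x y ∎
    where
    open ≡-Reasoning
    eₐ e_b y′ : Vec ℤ n
    eₐ = unitᵥ a (+ 1)
    e_b = unitᵥ b (+ 1)
    y′ = (y +ᵥ eₐ) −ᵥ e_b
    neg-involutive : ∀ u → - (+ 0 - u) ≡ u
    neg-involutive = solve-∀
    neg-minus : ∀ u v → - (u - v) ≡ v - u
    neg-minus = solve-∀
    relation-at : coeff P x y′ - coeff P x y ≡ + 0 - coeff S x y
    relation-at = begin
      coeff P x y′ - coeff P x y
        ≡⟨ cong (λ z → coeff P x y′ - coeff P x z) (+ᵥ-−ᵥ-cancel y eₐ) ⟨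
      coeff P x y′ - coeff P x ((y +ᵥ eₐ) −ᵥ eₐ)
        ≡⟨ coeff-ydiff-⊗ b a P x (y +ᵥ eₐ) ⟨
      coeff ((ypow b (+ 1) ⊖ ypow a (+ 1)) ⊗ P) x (y +ᵥ eₐ)
        ≡⟨ relation x (y +ᵥ eₐ) ⟩
      coeff (ypow b (+ 1) ⊗ Z ⊖ ypow a (+ 1) ⊗ S) x (y +ᵥ eₐ)
        ≡⟨ coeff-⊖ (ypow b (+ 1) ⊗ Z) (ypow a (+ 1) ⊗ S) x (y +ᵥ eₐ) ⟩
      coeff (ypow b (+ 1) ⊗ Z) x (y +ᵥ eₐ) - coeff (ypow a (+ 1) ⊗ S) x (y +ᵥ eₐ)
        ≡⟨ cong₂ _-_ (trans (coeff-ypow-⊗ b (+ 1) Z x (y +ᵥ eₐ)) (Z-vanishes x y′))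
                     (trans (coeff-ypow-⊗ a (+ 1) S x (y +ᵥ eₐ)) (cong (coeff S x) (+ᵥ-−ᵥ-cancel y eₐ))) ⟩
      + 0 - coeff S x y ∎

lemma3p4 : (n : ℕ) → 1 ≤ n → (G : OneLine n → Laurent n) → IsDoubleGrothendieck n G →
           (u : OneLine n) → IsPerm u → (i : ℕ) (h : suc i < n) →
           len (rightMulS u i h) < len u →
           specialize u (G u)
             ≈ (one ⊖ ypow (lookup u (pos+1 i h)) (+ 1) ⊗ ypow (lookup u (pos i h)) -[1+ 0 ])
               ⊗ specialize (rightMulS u i h) (G (rightMulS u i h))
lemma3p4 n _ G isG u perm i h shorter =
  solve-ydiff (lookup u K) (lookup u L) (specialize u′ (G u′)) (specialize u (G u)) (specialize u′ (G u)) relation G-u-vanishes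
  where
  open IsDoubleGrothendieck isG
  open AdjacentTransposition i h
  u′ : OneLine n
  u′ = rightMulS u i h
  descent : entry u (suc i) < entry u i
  descent = subst₂ _<_ (sym (entry-suc-i u)) (sym (entry-i u)) (length-descent u shorter)
  G-u-vanishes : IsZero (specialize u′ (G u))
  G-u-vanishes = Vanishing.vanishes G isG u perm u′ (injective-rightMulS u (IsPerm⇒injective u perm)) (NotBelow-descent u descent)
  u′-lengthens : len (rightMulS u′ i h) ≡ suc (len u′)
  u′-lengthens = len-rightMulS-ascent u′ (subst₂ Fin._<_ (sym (rightMulS-K u)) (sym (rightMulS-L u)) (length-descent u shorter))
  relation : (ypow (lookup u L) (+ 1) ⊖ ypow (lookup u K) (+ 1)) ⊗ specialize u′ (G u′)
               ≈ ypow (lookup u L) (+ 1) ⊗ specialize u′ (G u) ⊖ ypow (lookup u K) (+ 1) ⊗ specialize u (G u)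
  relation with specialize-divided-difference u′ (G u′) (G (rightMulS u′ i h)) (step u′ (IsPerm-rightMulS u perm) i h u′-lengthens)
  ... | specialized rewrite rightMulS-involutive u | rightMulS-K u | rightMulS-L u = specialized
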